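{- Let $\mathcal{D}$ be the set of all Dyck paths, and for $D\in\mathcal{D}$ let $|D|$ be its semilength, $\mathrm{sval}(D)$ its number of symmetric valleys, and $\mathrm{svw}(D)$ the sum of the weights of its symmetric valleys. For $k\ge1$ write $[k]_q=1+q+\dots+q^{k-1}$. Then $$\sum_{D\in\mathcal{D}}s^{\mathrm{sval}(D)}w^{\mathrm{svw}(D)}z^{|D|}=\cfrac{1}{1+z-\cfrac{z}{1+z[1]_z-swz[1]_{wz}}-\cfrac{z}{1+z-\cfrac{z}{1+z[2]_z-swz[2]_{wz}}-\cfrac{z}{1+z-\cfrac{z}{1+z[3]_z-swz[3]_{wz}}-\cfrac{z}{\ddots}}}}.$$
   Context: A Dyck path of semilength $n$ is a lattice path with steps $\mathbf{u}=(1,1)$ and $\mathbf{d}=(1,-1)$ from $(0,0)$ to $(2n,0)$ never going below the $x$-axis. A valley is an occurrence of consecutive steps $\mathbf{du}$. Every valley is contained in a unique maximal consecutive subsequence of the form $\mathbf{d}^i\mathbf{u}^j$ ($i,j\ge1$); the valley is symmetric if $i=j$, and in that case its weight is $i$ (the largest $i$ such that the valley lies in a consecutive subsequence $\mathbf{d}^i\mathbf{u}^i$). The continued fraction means $G_1$ where $G_k=1/\big(1+z-\frac{z}{1+z[k]_z-swz[k]_{wz}}-zG_{k+1}\big)$ for $k\ge1$, as a limit of truncations in formal power series. -}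

module Defs where

open import Data.Bool using (Bool; true; false; _∧_; if_then_else_)
open import Data.Nat as ℕ using (ℕ; zero; suc; _∸_; _≡ᵇ_; _≤ᵇ_)
open import Data.Integer as ℤ using (ℤ; +_)
open import Data.List using (List; []; _∷_; _++_; map; length; filterᵇ; concatMap)
open import Data.Product using (_×_; _,_; proj₁)
open import Data.Nat.ListAction using (sum)

data Step : Set where
  u d : Step

_≟ˢ_ : Step → Step → Bool
u ≟ˢ u = true
d ≟ˢ d = true
_ ≟ˢ _ = false

words : ℕ → List (List Step)
words zero    = [] ∷ []
words (suc m) = concatMap (λ w → (u ∷ w) ∷ (d ∷ w) ∷ []) (words m)

dyckFrom : ℕ → List Step → Bool
dyckFrom h       []       = h ≡ᵇ 0
dyckFrom h       (u ∷ xs) = dyckFrom (suc h) xs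
dyckFrom zero    (d ∷ xs) = false
dyckFrom (suc h) (d ∷ xs) = dyckFrom h xs

isDyck : List Step → Bool
isDyck = dyckFrom 0

dyckPaths : ℕ → List (List Step)
dyckPaths n = filterᵇ isDyck (words (n ℕ.+ n))

runs : List Step → List (Step × ℕ)
runs [] = []
runs (x ∷ xs) with runs xs
... | [] = (x , 1) ∷ []
... | (y , k) ∷ rs = if x ≟ˢ y then (y , suc k) ∷ rs else (x , 1) ∷ (y , k) ∷ rs

-- each valley du lies in a unique maximal d^i u^j; list the pairs (i , j)
valleysR : List (Step × ℕ) → List (ℕ × ℕ)
valleysR [] = []
valleysR ((d , i) ∷ rest@((u , j) ∷ _)) = (i , j) ∷ valleysR rest
valleysR (_ ∷ rest) = valleysR rest

valleys : List Step → List (ℕ × ℕ)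
valleys p = valleysR (runs p)

symValleys : List Step → List (ℕ × ℕ)
symValleys p = filterᵇ (λ { (i , j) → i ≡ᵇ j }) (valleys p)

sval : List Step → ℕ
sval p = length (symValleys p)

svw : List Step → ℕ
svw p = sum (map proj₁ (symValleys p))

-- Formal power series in z with coefficients in ℤ[s, w]
-- Poly : coefficient of s^a w^b ; Series : coefficient of z^n

Poly : Set
Poly = ℕ → ℕ → ℤ

Series : Set
Series = ℕ → Poly

Σ≤ : ℕ → (ℕ → ℤ) → ℤ
Σ≤ zero    f = f 0
Σ≤ (suc n) f = Σ≤ n f ℤ.+ f (suc n)

0ₚ 1ₚ : Poly
0ₚ a b = + 0
1ₚ zero zero = + 1
1ₚ _    _    = + 0

_+ₚ_ _-ₚ_ _*ₚ_ : Poly → Poly → Poly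
(p +ₚ q) a b = p a b ℤ.+ q a b
(p -ₚ q) a b = p a b ℤ.- q a b
(p *ₚ q) a b = Σ≤ a (λ i → Σ≤ b (λ j → p i j ℤ.* q (a ∸ i) (b ∸ j)))

Σ≤ₚ : ℕ → (ℕ → Poly) → Poly
Σ≤ₚ zero    f = f 0
Σ≤ₚ (suc n) f = Σ≤ₚ n f +ₚ f (suc n)

0ₛ 1ₛ zₛ sₛ wₛ : Series
0ₛ n = 0ₚ
1ₛ zero    = 1ₚ
1ₛ (suc n) = 0ₚ
zₛ (suc zero) = 1ₚ
zₛ _          = 0ₚ
sₛ zero (suc zero) zero = + 1
sₛ _    _          _    = + 0
wₛ zero zero (suc zero) = + 1
wₛ _    _    _          = + 0

infixl 6 _+ₛ_ _-ₛ_
infixl 7 _*ₛ_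

_+ₛ_ _-ₛ_ _*ₛ_ : Series → Series → Series
(F +ₛ G) n = F n +ₚ G n
(F -ₛ G) n = F n -ₚ G n
(F *ₛ G) n = Σ≤ₚ n (λ i → F i *ₚ G (n ∸ i))

_^ₛ_ : Series → ℕ → Series
F ^ₛ zero  = 1ₛ
F ^ₛ suc k = F *ₛ (F ^ₛ k)

-- Multiplicative inverse of a series F whose z^0-coefficient is 1:
-- H_0 = 1,  H_n = - Σ_{i=1}^{n} F_i H_{n-i}.
-- invTable F n j = H_j for j ≤ n.
invTable : Series → ℕ → ℕ → Poly
invTable F zero    j = 1ₛ j
invTable F (suc n) j =
  if j ≤ᵇ n then invTable F n j
  else (0ₚ -ₚ Σ≤ₚ n (λ i → F (suc i) *ₚ invTable F n (n ∸ i)))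

inv : Series → Series
inv F n = invTable F n n

[_]⟨_⟩ : ℕ → Series → Series
[ zero  ]⟨ q ⟩ = 0ₛ
[ suc k ]⟨ q ⟩ = [ k ]⟨ q ⟩ +ₛ q ^ₛ k

-- Truncations of the continued fraction:
-- G_k = 1 / (1 + z - z/(1 + z[k]_z - s w z [k]_{wz}) - z G_{k+1}),
-- truncated at depth N by setting G_{k+N} = 0.
Gtrunc : ℕ → ℕ → Series
Gtrunc zero    k = 0ₛ
Gtrunc (suc N) k =
  inv (1ₛ +ₛ zₛ
       -ₛ zₛ *ₛ inv (1ₛ +ₛ zₛ *ₛ [ k ]⟨ zₛ ⟩ -ₛ sₛ *ₛ wₛ *ₛ zₛ *ₛ [ k ]⟨ wₛ *ₛ zₛ ⟩)
       -ₛ zₛ *ₛ Gtrunc N (suc k))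

dyckGF : Series
dyckGF n a b = + length (filterᵇ (λ p → (sval p ≡ᵇ a) ∧ (svw p ≡ᵇ b)) (dyckPaths n))

-- Write s^sval w^svw as the product, over the symmetric valleys, of s w^i = 1 + (s w^i − 1) and
-- expand: the series becomes a signed sum over Dyck paths in which some symmetric valleys are
-- marked, a marked valley d^i u^i weighing s w^i − 1. A symmetric valley is a factor u d^i u^i d,
-- and marked valleys sharing their peaks form chains u d^i₁ u^i₁ d^i₂ u^i₂ … d that return to the
-- height h they start from and contain only valleys of depth i ≤ h + 1. Hence
-- H_k = 1/(1 + z[k]_z − swz[k]_{wz}) counts the chains starting at height k − 1, and G_k counts the
-- walks from height k − 1 back to it that stay weakly above it outside chains. Splitting such a walk
-- after its first chain, or at its first return to height k − 1, gives
-- G_k = 1 + z ((H_k − 1) + G_{k+1}) G_k, the recursion defining the continued fraction, so both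
-- sides agree at z^n once the truncation depth exceeds n.

module Submission where

open import Defs
open import Data.Nat using (ℕ; _≤_)
open import Data.Product using (∃-syntax)
open import Relation.Binary.PropositionalEquality using (_≡_)

open import Data.Bool using (Bool; true; false; not; T; _∧_; if_then_else_)
open import Data.Bool.Properties using (not-involutive; not-injective; not-¬)
open import Data.Empty using (⊥-elim)
open import Data.Integer using (ℤ; +_; 0ℤ; _+_; _-_; -_; _*_)
import Data.Integer.Properties as ℤ
open import Data.Integer.Tactic.RingSolver using (solve-∀)
open import Data.Nat.Tactic.RingSolver using () renaming (solve-∀ to ℕsolve-∀)
open import Data.Nat.Induction using (<-rec)
open import Data.List using (List; []; _∷_; _++_; length; replicate; map; filterᵇ; concatMap)
open import Data.List.Properties using (++-identityʳ; length-++)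
open import Data.Nat as ℕ using (zero; suc; _<_; _∸_; _≡ᵇ_; _<ᵇ_; z≤n; s≤s)
  renaming (_+_ to _⊕_)
open import Data.Nat.ListAction using (sum)
open import Data.Nat.Properties as ℕ
  using (≤-refl; ≤-trans; m≤n⇒m≤1+n; <⇒≤; ≤-pred; <⇒≢; ≤∧≢⇒<; <-irrefl; <⇒≱; m∸n≤m; +-suc; +-identityʳ)
open import Data.Product using (_×_; _,_; proj₁; ∃₂)
open import Function using (_∘_)
open import Level using (0ℓ)
open import Relation.Binary.Bundles using (Setoid)
open import Relation.Binary.PropositionalEquality using (refl; sym; trans; cong; cong₂; subst; _≢_)
open import Relation.Nullary using (yes; no; ¬_)

Σ≤-cong : ∀ n {f g : ℕ → ℤ} → (∀ i → i ≤ n → f i ≡ g i) → Σ≤ n f ≡ Σ≤ n g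
Σ≤-cong zero    f≗g = f≗g 0 z≤n
Σ≤-cong (suc n) f≗g =
  cong₂ _+_ (Σ≤-cong n (λ i i≤n → f≗g i (m≤n⇒m≤1+n i≤n))) (f≗g (suc n) ≤-refl)

Σ≤-zero : ∀ n {f : ℕ → ℤ} → (∀ i → i ≤ n → f i ≡ 0ℤ) → Σ≤ n f ≡ 0ℤ
Σ≤-zero zero    f≗0 = f≗0 0 z≤n
Σ≤-zero (suc n) f≗0 =
  cong₂ _+_ (Σ≤-zero n (λ i i≤n → f≗0 i (m≤n⇒m≤1+n i≤n))) (f≗0 (suc n) ≤-refl)

Σ≤-+ : ∀ n (f g : ℕ → ℤ) → Σ≤ n (λ i → f i + g i) ≡ Σ≤ n f + Σ≤ n g
Σ≤-+ zero    f g = refl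
Σ≤-+ (suc n) f g =
  trans (cong (_+ (f (suc n) + g (suc n))) (Σ≤-+ n f g)) (interchange (Σ≤ n f) (Σ≤ n g) (f (suc n)) (g (suc n)))
  where
  interchange : ∀ a b c e → a + b + (c + e) ≡ a + c + (b + e)
  interchange = solve-∀

Σ≤-neg : ∀ n (f : ℕ → ℤ) → Σ≤ n (λ i → - f i) ≡ - Σ≤ n f
Σ≤-neg zero    f = refl
Σ≤-neg (suc n) f = trans (cong (_+ - f (suc n)) (Σ≤-neg n f)) (sym (ℤ.neg-distrib-+ (Σ≤ n f) (f (suc n))))

Σ≤-suc-first : ∀ n (f : ℕ → ℤ) → Σ≤ (suc n) f ≡ f 0 + Σ≤ n (f ∘ suc)
Σ≤-suc-first zero    f = refl
Σ≤-suc-first (suc n) f = trans (cong (_+ f (suc (suc n))) (Σ≤-suc-first n f)) (ℤ.+-assoc (f 0) _ _)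

Σ≤-single : ∀ n j (f : ℕ → ℤ) → j ≤ n → (∀ i → i ≤ n → i ≢ j → f i ≡ 0ℤ) → Σ≤ n f ≡ f j
Σ≤-single zero    .zero f z≤n _ = refl
Σ≤-single (suc n) j f j≤1+n f≗0 with j ℕ.≟ suc n
... | yes refl = trans (cong (_+ f (suc n)) (Σ≤-zero n (λ i i≤n → f≗0 i (m≤n⇒m≤1+n i≤n) (<⇒≢ (s≤s i≤n)))))
                       (ℤ.+-identityˡ _)
... | no j≢1+n = trans (cong₂ _+_ (Σ≤-single n j f (≤-pred (≤∧≢⇒< j≤1+n j≢1+n)) (λ i i≤n → f≗0 i (m≤n⇒m≤1+n i≤n)))
                                  (f≗0 (suc n) ≤-refl (j≢1+n ∘ sym)))
                       (ℤ.+-identityʳ _)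

infix 4 _≋_
_≋_ : Poly → Poly → Set
p ≋ q = ∀ a b → p a b ≡ q a b

≋-setoid : Setoid 0ℓ 0ℓ
≋-setoid = record
  { Carrier = Poly
  ; _≈_ = _≋_
  ; isEquivalence = record
    { refl = λ a b → refl
    ; sym = λ p≋q a b → sym (p≋q a b)
    ; trans = λ p≋q q≋r a b → trans (p≋q a b) (q≋r a b)
    }
  }

open Setoid ≋-setoid using () renaming (refl to ≋-refl; sym to ≋-sym; trans to ≋-trans)
open import Relation.Binary.Reasoning.Setoid ≋-setoid

≡⇒≋ : ∀ {p q} → p ≡ q → p ≋ q
≡⇒≋ refl = ≋-refl

-ₚ_ : Poly → Poly
(-ₚ p) a b = - p a b

+ₚ-cong : ∀ {p p′ q q′} → p ≋ p′ → q ≋ q′ → p +ₚ q ≋ p′ +ₚ q′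
+ₚ-cong p≋p′ q≋q′ a b = cong₂ _+_ (p≋p′ a b) (q≋q′ a b)

-ₚ-cong : ∀ {p p′ q q′} → p ≋ p′ → q ≋ q′ → p -ₚ q ≋ p′ -ₚ q′
-ₚ-cong p≋p′ q≋q′ a b = cong₂ _-_ (p≋p′ a b) (q≋q′ a b)

*ₚ-cong : ∀ {p p′ q q′} → p ≋ p′ → q ≋ q′ → p *ₚ q ≋ p′ *ₚ q′
*ₚ-cong p≋p′ q≋q′ a b = Σ≤-cong a (λ i _ → Σ≤-cong b (λ j _ → cong₂ _*_ (p≋p′ i j) (q≋q′ _ _)))

+ₚ-identityˡ : ∀ p → 0ₚ +ₚ p ≋ p
+ₚ-identityˡ p a b = ℤ.+-identityˡ (p a b)

+ₚ-identityʳ : ∀ p → p +ₚ 0ₚ ≋ p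
+ₚ-identityʳ p a b = ℤ.+-identityʳ (p a b)

+ₚ-comm : ∀ p q → p +ₚ q ≋ q +ₚ p
+ₚ-comm p q a b = ℤ.+-comm (p a b) (q a b)

*ₚ-distribʳ-+ₚ : ∀ p q r → (p +ₚ q) *ₚ r ≋ (p *ₚ r) +ₚ (q *ₚ r)
*ₚ-distribʳ-+ₚ p q r a b =
  trans (Σ≤-cong a (λ i _ → trans (Σ≤-cong b (λ j _ → ℤ.*-distribʳ-+ (r (a ∸ i) (b ∸ j)) (p i j) (q i j)))
                                  (Σ≤-+ b _ _)))
        (Σ≤-+ a _ _)

*ₚ-distribˡ-+ₚ : ∀ p q r → p *ₚ (q +ₚ r) ≋ (p *ₚ q) +ₚ (p *ₚ r)
*ₚ-distribˡ-+ₚ p q r a b =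
  trans (Σ≤-cong a (λ i _ → trans (Σ≤-cong b (λ j _ → ℤ.*-distribˡ-+ (p i j) (q (a ∸ i) (b ∸ j)) _))
                                  (Σ≤-+ b _ _)))
        (Σ≤-+ a _ _)

-ₚ-distribˡ-*ₚ : ∀ p q → (-ₚ p) *ₚ q ≋ -ₚ (p *ₚ q)
-ₚ-distribˡ-*ₚ p q a b =
  trans (Σ≤-cong a (λ i _ → trans (Σ≤-cong b (λ j _ → sym (ℤ.neg-distribˡ-* (p i j) _))) (Σ≤-neg b _)))
        (Σ≤-neg a _)

*ₚ-zeroˡ : ∀ p → 0ₚ *ₚ p ≋ 0ₚ
*ₚ-zeroˡ p a b = Σ≤-zero a (λ i _ → Σ≤-zero b (λ j _ → refl))

*ₚ-zeroʳ : ∀ p → p *ₚ 0ₚ ≋ 0ₚ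
*ₚ-zeroʳ p a b = Σ≤-zero a (λ i _ → Σ≤-zero b (λ j _ → ℤ.*-zeroʳ (p i j)))

Σ≤-1ₚ-row : ∀ b (g : ℕ → ℤ) → Σ≤ b (λ j → 1ₚ 0 j * g (b ∸ j)) ≡ g b
Σ≤-1ₚ-row zero    g = ℤ.*-identityˡ (g 0)
Σ≤-1ₚ-row (suc b) g =
  trans (Σ≤-suc-first b _)
        (trans (cong₂ _+_ (ℤ.*-identityˡ (g (suc b))) (Σ≤-zero b (λ j _ → refl))) (ℤ.+-identityʳ (g (suc b))))

*ₚ-identityˡ : ∀ p → 1ₚ *ₚ p ≋ p
*ₚ-identityˡ p zero    b = Σ≤-1ₚ-row b (p 0)
*ₚ-identityˡ p (suc a) b =
  trans (Σ≤-suc-first a _)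
        (trans (cong₂ _+_ (Σ≤-1ₚ-row b (p (suc a))) (Σ≤-zero a (λ i _ → Σ≤-zero b (λ j _ → refl))))
               (ℤ.+-identityʳ _))

record IsLinear (L : Poly → Poly) : Set where
  field
    ≋-cong : ∀ {p q} → p ≋ q → L p ≋ L q
    +ₚ-homo : ∀ p q → L (p +ₚ q) ≋ (L p +ₚ L q)
    0ₚ-homo : L 0ₚ ≋ 0ₚ

  -ₚ-homo : ∀ p q → L (p -ₚ q) ≋ (L p -ₚ L q)
  -ₚ-homo p q a b = trans (sym (cancel (L (p -ₚ q) a b) (L q a b))) (cong (_- L q a b) (sym (split a b)))
    where
    cancel : ∀ x y → x + y - y ≡ x
    cancel = solve-∀
    uncancel : ∀ x y → x - y + y ≡ x
    uncancel = solve-∀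
    split : L p ≋ (L (p -ₚ q) +ₚ L q)
    split = ≋-trans (≋-cong (λ a b → sym (uncancel (p a b) (q a b)))) (+ₚ-homo (p -ₚ q) q)

  vanishes : ∀ {p} → p ≋ 0ₚ → L p ≋ 0ₚ
  vanishes p≋0 = ≋-trans (≋-cong p≋0) 0ₚ-homo

open IsLinear

*ₚ-linearˡ : ∀ q → IsLinear (_*ₚ q)
*ₚ-linearˡ q = record
  { ≋-cong = λ p≋p′ → *ₚ-cong p≋p′ (≋-refl {q})
  ; +ₚ-homo = λ p p′ → *ₚ-distribʳ-+ₚ p p′ q
  ; 0ₚ-homo = *ₚ-zeroˡ q
  }

*ₚ-linearʳ : ∀ p → IsLinear (p *ₚ_)
*ₚ-linearʳ p = record
  { ≋-cong = *ₚ-cong (≋-refl {p})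
  ; +ₚ-homo = *ₚ-distribˡ-+ₚ p
  ; 0ₚ-homo = *ₚ-zeroʳ p
  }

∘-linear : ∀ {L L′} → IsLinear L → IsLinear L′ → IsLinear (L ∘ L′)
∘-linear L-lin L′-lin = record
  { ≋-cong = ≋-cong L-lin ∘ ≋-cong L′-lin
  ; +ₚ-homo = λ p q → ≋-trans (≋-cong L-lin (+ₚ-homo L′-lin p q)) (+ₚ-homo L-lin _ _)
  ; 0ₚ-homo = vanishes L-lin (0ₚ-homo L′-lin)
  }

infixr 25 s^_·_ w^_·_ [_]·_

s^_·_ : ℕ → Poly → Poly
s^ zero  · p = p
(s^ suc k · p) zero    b = 0ℤ
(s^ suc k · p) (suc a) b = (s^ k · p) a b

w^_·_ : ℕ → Poly → Poly
w^ zero  · p = p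
(w^ suc k · p) a zero    = 0ℤ
(w^ suc k · p) a (suc b) = (w^ k · p) a b

s^-linear : ∀ k → IsLinear (s^ k ·_)
s^-linear k = record { ≋-cong = cong′ k ; +ₚ-homo = +-homo k ; 0ₚ-homo = 0-homo k }
  where
  cong′ : ∀ k {p q} → p ≋ q → s^ k · p ≋ s^ k · q
  cong′ zero    p≋q = p≋q
  cong′ (suc k) p≋q zero    b = refl
  cong′ (suc k) p≋q (suc a) b = cong′ k p≋q a b
  +-homo : ∀ k p q → s^ k · (p +ₚ q) ≋ (s^ k · p +ₚ s^ k · q)
  +-homo zero    p q = ≋-refl
  +-homo (suc k) p q zero    b = refl
  +-homo (suc k) p q (suc a) b = +-homo k p q a b
  0-homo : ∀ k → s^ k · 0ₚ ≋ 0ₚ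
  0-homo zero    = ≋-refl
  0-homo (suc k) zero    b = refl
  0-homo (suc k) (suc a) b = 0-homo k a b

w^-linear : ∀ k → IsLinear (w^ k ·_)
w^-linear k = record { ≋-cong = cong′ k ; +ₚ-homo = +-homo k ; 0ₚ-homo = 0-homo k }
  where
  cong′ : ∀ k {p q} → p ≋ q → w^ k · p ≋ w^ k · q
  cong′ zero    p≋q = p≋q
  cong′ (suc k) p≋q a zero    = refl
  cong′ (suc k) p≋q a (suc b) = cong′ k p≋q a b
  +-homo : ∀ k p q → w^ k · (p +ₚ q) ≋ (w^ k · p +ₚ w^ k · q)
  +-homo zero    p q = ≋-refl
  +-homo (suc k) p q a zero    = refl
  +-homo (suc k) p q a (suc b) = +-homo k p q a b
  0-homo : ∀ k → w^ k · 0ₚ ≋ 0ₚ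
  0-homo zero    = ≋-refl
  0-homo (suc k) a zero    = refl
  0-homo (suc k) a (suc b) = 0-homo k a b

s^-*ₚ : ∀ k p q → (s^ k · p) *ₚ q ≋ s^ k · (p *ₚ q)
s^-*ₚ zero    p q = ≋-refl
s^-*ₚ (suc k) p q zero    b = Σ≤-zero b (λ j _ → ℤ.*-zeroˡ (q 0 (b ∸ j)))
s^-*ₚ (suc k) p q (suc a) b =
  trans (Σ≤-suc-first a _)
        (trans (cong₂ _+_ (Σ≤-zero b (λ j _ → ℤ.*-zeroˡ (q (suc a) (b ∸ j)))) refl)
               (trans (ℤ.+-identityˡ _) (s^-*ₚ k p q a b)))

w^-*ₚ : ∀ k p q → (w^ k · p) *ₚ q ≋ w^ k · (p *ₚ q)
w^-*ₚ zero    p q = ≋-refl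
w^-*ₚ (suc k) p q a zero    = Σ≤-zero a (λ i _ → ℤ.*-zeroˡ (q (a ∸ i) 0))
w^-*ₚ (suc k) p q a (suc b) =
  trans (Σ≤-cong a (λ i _ → trans (Σ≤-suc-first b _)
                                  (trans (cong (_+ rest i) (ℤ.*-zeroˡ (q (a ∸ i) (suc b)))) (ℤ.+-identityˡ (rest i)))))
        (w^-*ₚ k p q a b)
  where
  rest : ℕ → ℤ
  rest i = Σ≤ b (λ j → (w^ k · p) i j * q (a ∸ i) (b ∸ j))

w^-+ : ∀ k m p → w^ k · w^ m · p ≋ w^ (k ⊕ m) · p
w^-+ zero    m p = ≋-refl
w^-+ (suc k) m p a zero    = refl
w^-+ (suc k) m p a (suc b) = w^-+ k m p a b

monomial : ℕ → ℕ → Poly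
monomial x y = s^ x · w^ y · 1ₚ

monomial-*ₚ : ∀ x y q → monomial x y *ₚ q ≋ s^ x · w^ y · q
monomial-*ₚ x y q = begin
  (s^ x · w^ y · 1ₚ) *ₚ q   ≈⟨ s^-*ₚ x _ q ⟩
  s^ x · ((w^ y · 1ₚ) *ₚ q) ≈⟨ ≋-cong (s^-linear x) (w^-*ₚ y 1ₚ q) ⟩
  s^ x · w^ y · (1ₚ *ₚ q)   ≈⟨ ≋-cong (∘-linear (s^-linear x) (w^-linear y)) (*ₚ-identityˡ q) ⟩
  s^ x · w^ y · q           ∎

[_]·_ : Bool → Poly → Poly
[ true  ]· p = p
[ false ]· p = 0ₚ

[]·-linear : ∀ b → IsLinear ([ b ]·_)
[]·-linear true  = record { ≋-cong = λ p≋q → p≋q ; +ₚ-homo = λ _ _ → ≋-refl ; 0ₚ-homo = ≋-refl }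
[]·-linear false = record { ≋-cong = λ _ → ≋-refl ; +ₚ-homo = λ _ _ a b → refl ; 0ₚ-homo = ≋-refl }

[]·-cong : ∀ b {p q} → (T b → p ≋ q) → [ b ]· p ≋ [ b ]· q
[]·-cong true  p≋q = p≋q _
[]·-cong false _   = ≋-refl

[]·-commute : ∀ {L} → IsLinear L → ∀ b p → L ([ b ]· p) ≋ [ b ]· L p
[]·-commute L-lin true  p = ≋-refl
[]·-commute L-lin false p = 0ₚ-homo L-lin

[]·-true : ∀ {b} p → T b → [ b ]· p ≋ p
[]·-true {true} p _ = ≋-refl

[]·-false : ∀ {b} p → ¬ T b → [ b ]· p ≋ 0ₚ
[]·-false {true}  p ¬b = ⊥-elim (¬b _)
[]·-false {false} p _  = ≋-refl

[]·-<ᵇ-suc : ∀ n k p → [ n <ᵇ suc k ]· p ≋ ([ n <ᵇ k ]· p +ₚ [ n ≡ᵇ k ]· p)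
[]·-<ᵇ-suc zero    zero    p = ≋-sym (+ₚ-identityˡ p)
[]·-<ᵇ-suc zero    (suc k) p = ≋-sym (+ₚ-identityʳ p)
[]·-<ᵇ-suc (suc n) zero    p a b = refl
[]·-<ᵇ-suc (suc n) (suc k) p = []·-<ᵇ-suc n k p

Σ≤ₚ-eval : ∀ n (f : ℕ → Poly) a b → Σ≤ₚ n f a b ≡ Σ≤ n (λ i → f i a b)
Σ≤ₚ-eval zero    f a b = refl
Σ≤ₚ-eval (suc n) f a b = cong (_+ f (suc n) a b) (Σ≤ₚ-eval n f a b)

Σ≤ₚ-cong : ∀ n {f g : ℕ → Poly} → (∀ i → i ≤ n → f i ≋ g i) → Σ≤ₚ n f ≋ Σ≤ₚ n g
Σ≤ₚ-cong n {f} {g} f≋g a b =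
  trans (Σ≤ₚ-eval n f a b) (trans (Σ≤-cong n (λ i i≤n → f≋g i i≤n a b)) (sym (Σ≤ₚ-eval n g a b)))

Σ≤ₚ-zero : ∀ n {f : ℕ → Poly} → (∀ i → i ≤ n → f i ≋ 0ₚ) → Σ≤ₚ n f ≋ 0ₚ
Σ≤ₚ-zero n {f} f≋0 a b = trans (Σ≤ₚ-eval n f a b) (Σ≤-zero n (λ i i≤n → f≋0 i i≤n a b))

Σ≤ₚ-single : ∀ n j (f : ℕ → Poly) → j ≤ n → (∀ i → i ≤ n → i ≢ j → f i ≋ 0ₚ) → Σ≤ₚ n f ≋ f j
Σ≤ₚ-single n j f j≤n f≋0 a b =
  trans (Σ≤ₚ-eval n f a b) (Σ≤-single n j (λ i → f i a b) j≤n (λ i i≤n i≢j → f≋0 i i≤n i≢j a b))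

Σ≤ₚ-+ : ∀ n (f g : ℕ → Poly) → Σ≤ₚ n (λ i → f i +ₚ g i) ≋ (Σ≤ₚ n f +ₚ Σ≤ₚ n g)
Σ≤ₚ-+ n f g a b =
  trans (Σ≤ₚ-eval n _ a b)
        (trans (Σ≤-+ n (λ i → f i a b) (λ i → g i a b)) (sym (cong₂ _+_ (Σ≤ₚ-eval n f a b) (Σ≤ₚ-eval n g a b))))

Σ≤ₚ-neg : ∀ n (f : ℕ → Poly) → Σ≤ₚ n (λ i → -ₚ f i) ≋ -ₚ Σ≤ₚ n f
Σ≤ₚ-neg n f a b =
  trans (Σ≤ₚ-eval n _ a b) (trans (Σ≤-neg n (λ i → f i a b)) (cong -_ (sym (Σ≤ₚ-eval n f a b))))

Σ≤ₚ-suc-first : ∀ n (f : ℕ → Poly) → Σ≤ₚ (suc n) f ≋ (f 0 +ₚ Σ≤ₚ n (f ∘ suc))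
Σ≤ₚ-suc-first n f a b =
  trans (Σ≤ₚ-eval (suc n) f a b)
        (trans (Σ≤-suc-first n (λ i → f i a b)) (cong (λ x → f 0 a b + x) (sym (Σ≤ₚ-eval n (f ∘ suc) a b))))

odd : ℕ → Bool
odd zero    = false
odd (suc n) = not (odd n)

odd-+-suc : ∀ m n → odd (m ⊕ suc n) ≡ not (odd (m ⊕ n))
odd-+-suc m n = cong odd (+-suc m n)

odd-double : ∀ n → odd (n ⊕ n) ≡ false
odd-double zero    = refl
odd-double (suc n) = trans (cong not (odd-+-suc n n)) (trans (not-involutive _) (odd-double n))

not-swap : ∀ {x y} → not x ≡ y → x ≡ not y
not-swap {x} ¬x≡y = trans (sym (not-involutive x)) (cong not ¬x≡y)

Σ≤ₚ-truncate : ∀ t r (g : ℕ → Poly) → (∀ e → t < e → g e ≋ 0ₚ) → Σ≤ₚ (t ⊕ r) g ≋ Σ≤ₚ t g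
Σ≤ₚ-truncate t zero    g g≋0 = ≡⇒≋ (cong (λ n → Σ≤ₚ n g) (+-identityʳ t))
Σ≤ₚ-truncate t (suc r) g g≋0 rewrite +-suc t r =
  ≋-trans (+ₚ-cong (Σ≤ₚ-truncate t r g g≋0) (g≋0 (suc (t ⊕ r)) (s≤s (ℕ.m≤m+n t r)))) (+ₚ-identityʳ _)

Σ≤ₚ-evens : ∀ n (g : ℕ → Poly) → (∀ a → odd a ≡ true → g a ≋ 0ₚ) → Σ≤ₚ (n ⊕ n) g ≋ Σ≤ₚ n (λ i → g (i ⊕ i))
Σ≤ₚ-evens zero    g g≋0 = ≋-refl
Σ≤ₚ-evens (suc n) g g≋0 = begin
  Σ≤ₚ (suc n ⊕ suc n) g
    ≈⟨ ≡⇒≋ (cong (λ k → Σ≤ₚ (suc k) g) (+-suc n n)) ⟩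
  (Σ≤ₚ (n ⊕ n) g +ₚ g (suc (n ⊕ n))) +ₚ g (suc (suc (n ⊕ n)))
    ≈⟨ +ₚ-cong (≋-trans (+ₚ-cong (Σ≤ₚ-evens n g g≋0) (g≋0 (suc (n ⊕ n)) (cong not (odd-double n))))
                        (+ₚ-identityʳ (Σ≤ₚ n (λ i → g (i ⊕ i)))))
               (≡⇒≋ (cong (g ∘ suc) (sym (+-suc n n)))) ⟩
  Σ≤ₚ n (λ i → g (i ⊕ i)) +ₚ g (suc n ⊕ suc n) ∎

Σ≤ₚ-odds : ∀ n (g : ℕ → Poly) → (∀ a → odd a ≡ false → g a ≋ 0ₚ) →
           Σ≤ₚ (suc (n ⊕ n)) g ≋ Σ≤ₚ n (λ i → g (suc (i ⊕ i)))
Σ≤ₚ-odds zero    g g≋0 = ≋-trans (+ₚ-cong (g≋0 0 refl) (≋-refl {g 1})) (+ₚ-identityˡ (g 1))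
Σ≤ₚ-odds (suc n) g g≋0 = begin
  Σ≤ₚ (suc (suc n ⊕ suc n)) g
    ≈⟨ ≡⇒≋ (cong (λ k → Σ≤ₚ (suc (suc k)) g) (+-suc n n)) ⟩
  (Σ≤ₚ (suc (n ⊕ n)) g +ₚ g (suc (suc (n ⊕ n)))) +ₚ g (suc (suc (suc (n ⊕ n))))
    ≈⟨ +ₚ-cong (≋-trans (+ₚ-cong (Σ≤ₚ-odds n g g≋0) (g≋0 (suc (suc (n ⊕ n))) (trans (not-involutive _) (odd-double n))))
                        (+ₚ-identityʳ (Σ≤ₚ n (λ i → g (suc (i ⊕ i))))))
               (≡⇒≋ (cong (g ∘ suc ∘ suc) (sym (+-suc n n)))) ⟩
  Σ≤ₚ n (λ i → g (suc (i ⊕ i))) +ₚ g (suc (suc n ⊕ suc n)) ∎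

double-∸ : ∀ n i → i ≤ n → (n ⊕ n) ∸ (i ⊕ i) ≡ (n ∸ i) ⊕ (n ∸ i)
double-∸ n i i≤n = subst (λ n → (n ⊕ n) ∸ (i ⊕ i) ≡ (n ∸ i) ⊕ (n ∸ i)) (ℕ.m+[n∸m]≡n i≤n) (cancel i (n ∸ i))
  where
  regroup : ∀ i s → (i ⊕ s) ⊕ (i ⊕ s) ≡ (i ⊕ i) ⊕ (s ⊕ s)
  regroup = ℕsolve-∀
  cancel : ∀ i s → ((i ⊕ s) ⊕ (i ⊕ s)) ∸ (i ⊕ i) ≡ ((i ⊕ s) ∸ i) ⊕ ((i ⊕ s) ∸ i)
  cancel i s = trans (cong (_∸ (i ⊕ i)) (regroup i s))
                     (trans (ℕ.m+n∸m≡n (i ⊕ i) (s ⊕ s)) (sym (cong (λ k → k ⊕ k) (ℕ.m+n∸m≡n i s))))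

-- Power series in z and the continued fraction

Homogeneous : ℕ → Series → Set
Homogeneous e E = ∀ i → i ≢ e → E i ≋ 0ₚ

*ₛ-homogeneous : ∀ {e E} F → Homogeneous e E → ∀ n → e ≤ n → (E *ₛ F) n ≋ (E e *ₚ F (n ∸ e))
*ₛ-homogeneous {e} {E} F E-hom n e≤n =
  Σ≤ₚ-single n e (λ i → E i *ₚ F (n ∸ i)) e≤n
    (λ i _ i≢e → vanishes (*ₚ-linearˡ (F (n ∸ i))) (E-hom i i≢e))

*ₛ-homogeneous-< : ∀ {e E} F → Homogeneous e E → ∀ n → n < e → (E *ₛ F) n ≋ 0ₚ
*ₛ-homogeneous-< {e} {E} F E-hom n n<e =
  Σ≤ₚ-zero n (λ i i≤n → vanishes (*ₚ-linearˡ (F (n ∸ i))) (E-hom i (λ { refl → <⇒≱ n<e i≤n })))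

*ₛ-homogeneous-+ : ∀ {e e′ E F} → Homogeneous e E → Homogeneous e′ F → Homogeneous (e ⊕ e′) (E *ₛ F)
*ₛ-homogeneous-+ {e} {e′} {E} {F} E-hom F-hom n n≢e+e′ with e ℕ.≤? n
... | yes e≤n = ≋-trans (*ₛ-homogeneous F E-hom n e≤n)
                        (vanishes (*ₚ-linearʳ (E e)) (F-hom (n ∸ e) λ n∸e≡e′ →
                          n≢e+e′ (trans (sym (ℕ.m+[n∸m]≡n e≤n)) (cong (e ⊕_) n∸e≡e′))))
... | no  e≰n = *ₛ-homogeneous-< F E-hom n (ℕ.≰⇒> e≰n)

*ₛ-homogeneous-coeff : ∀ {e E} F → Homogeneous e E → ∀ e′ → (E *ₛ F) (e ⊕ e′) ≋ (E e *ₚ F e′)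
*ₛ-homogeneous-coeff {e} {E} F E-hom e′ =
  ≋-trans (*ₛ-homogeneous F E-hom (e ⊕ e′) (ℕ.m≤m+n e e′)) (≡⇒≋ (cong (λ k → E e *ₚ F k) (ℕ.m+n∸m≡n e e′)))

zₛ-homogeneous : Homogeneous 1 zₛ
zₛ-homogeneous zero          _   = ≋-refl
zₛ-homogeneous (suc zero)    1≢1 = ⊥-elim (1≢1 refl)
zₛ-homogeneous (suc (suc i)) _   = ≋-refl

sₛ-homogeneous : Homogeneous 0 sₛ
sₛ-homogeneous zero    0≢0 = ⊥-elim (0≢0 refl)
sₛ-homogeneous (suc i) _   a b = refl

wₛ-homogeneous : Homogeneous 0 wₛ
wₛ-homogeneous zero    0≢0 = ⊥-elim (0≢0 refl)
wₛ-homogeneous (suc i) _   a b = refl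

sₛ-coeff : sₛ 0 ≋ monomial 1 0
sₛ-coeff zero          b       = refl
sₛ-coeff (suc zero)    zero    = refl
sₛ-coeff (suc zero)    (suc b) = refl
sₛ-coeff (suc (suc a)) zero    = refl
sₛ-coeff (suc (suc a)) (suc b) = refl

wₛ-coeff : wₛ 0 ≋ monomial 0 1
wₛ-coeff zero    zero          = refl
wₛ-coeff zero    (suc zero)    = refl
wₛ-coeff zero    (suc (suc b)) = refl
wₛ-coeff (suc a) zero          = refl
wₛ-coeff (suc a) (suc zero)    = refl
wₛ-coeff (suc a) (suc (suc b)) = refl

wz-coeff : (wₛ *ₛ zₛ) 1 ≋ monomial 0 1
wz-coeff = begin
  (wₛ *ₛ zₛ) 1     ≈⟨ *ₛ-homogeneous-coeff zₛ wₛ-homogeneous 1 ⟩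
  wₛ 0 *ₚ 1ₚ        ≈⟨ *ₚ-cong wₛ-coeff (≋-refl {1ₚ}) ⟩
  monomial 0 1 *ₚ 1ₚ ≈⟨ monomial-*ₚ 0 1 1ₚ ⟩
  monomial 0 1      ∎

swz-coeff : (sₛ *ₛ wₛ *ₛ zₛ) 1 ≋ monomial 1 1
swz-coeff = begin
  (sₛ *ₛ wₛ *ₛ zₛ) 1          ≈⟨ *ₛ-homogeneous-coeff zₛ (*ₛ-homogeneous-+ sₛ-homogeneous wₛ-homogeneous) 1 ⟩
  (sₛ *ₛ wₛ) 0 *ₚ 1ₚ           ≈⟨ *ₚ-cong (*ₛ-homogeneous-coeff wₛ sₛ-homogeneous 0) (≋-refl {1ₚ}) ⟩
  (sₛ 0 *ₚ wₛ 0) *ₚ 1ₚ         ≈⟨ *ₚ-cong (*ₚ-cong sₛ-coeff wₛ-coeff) (≋-refl {1ₚ}) ⟩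
  (monomial 1 0 *ₚ monomial 0 1) *ₚ 1ₚ ≈⟨ *ₚ-cong (monomial-*ₚ 1 0 (monomial 0 1)) (≋-refl {1ₚ}) ⟩
  monomial 1 1 *ₚ 1ₚ            ≈⟨ monomial-*ₚ 1 1 1ₚ ⟩
  monomial 1 1                  ∎

module DegreeOne {E : Series} (E-hom : Homogeneous 1 E) where

  *ₛ-zero : ∀ F → (E *ₛ F) 0 ≋ 0ₚ
  *ₛ-zero F = *ₛ-homogeneous-< F E-hom 0 (s≤s z≤n)

  *ₛ-suc : ∀ F n → (E *ₛ F) (suc n) ≋ (E 1 *ₚ F n)
  *ₛ-suc F n = *ₛ-homogeneous-coeff F E-hom n

  module _ {c : ℕ} (E-coeff : E 1 ≋ monomial 0 c) where

    ^ₛ-coeff : ∀ m n → (E ^ₛ m) n ≋ [ n ≡ᵇ m ]· monomial 0 (n ℕ.* c)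
    ^ₛ-coeff zero    zero    = ≋-refl
    ^ₛ-coeff zero    (suc n) = ≋-refl
    ^ₛ-coeff (suc m) zero    = *ₛ-zero (E ^ₛ m)
    ^ₛ-coeff (suc m) (suc n) = begin
      (E *ₛ E ^ₛ m) (suc n)                           ≈⟨ *ₛ-suc (E ^ₛ m) n ⟩
      E 1 *ₚ (E ^ₛ m) n                                ≈⟨ *ₚ-cong E-coeff (^ₛ-coeff m n) ⟩
      monomial 0 c *ₚ [ n ≡ᵇ m ]· monomial 0 (n ℕ.* c) ≈⟨ monomial-*ₚ 0 c _ ⟩
      w^ c · [ n ≡ᵇ m ]· monomial 0 (n ℕ.* c)          ≈⟨ []·-commute (w^-linear c) (n ≡ᵇ m) _ ⟩
      [ n ≡ᵇ m ]· w^ c · w^ (n ℕ.* c) · 1ₚ             ≈⟨ []·-cong (n ≡ᵇ m) (λ _ → w^-+ c (n ℕ.* c) 1ₚ) ⟩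
      [ n ≡ᵇ m ]· monomial 0 (c ⊕ n ℕ.* c)             ∎

    q-integer-coeff : ∀ k n → [ k ]⟨ E ⟩ n ≋ [ n <ᵇ k ]· monomial 0 (n ℕ.* c)
    q-integer-coeff zero    n = ≋-refl
    q-integer-coeff (suc k) n =
      ≋-trans (+ₚ-cong (q-integer-coeff k n) (^ₛ-coeff k n)) (≋-sym ([]·-<ᵇ-suc n k _))

B : ℕ → Series
B k = 1ₛ +ₛ zₛ *ₛ [ k ]⟨ zₛ ⟩ -ₛ sₛ *ₛ wₛ *ₛ zₛ *ₛ [ k ]⟨ wₛ *ₛ zₛ ⟩

B-suc : ∀ k j → B k (suc j) ≋ [ j <ᵇ k ]· (1ₚ -ₚ monomial 1 (suc j))
B-suc k j = begin
  B k (suc j)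
    ≈⟨ -ₚ-cong (+ₚ-cong (≋-refl {0ₚ}) (Z.*ₛ-suc [ k ]⟨ zₛ ⟩ j)) (SWZ.*ₛ-suc [ k ]⟨ wₛ *ₛ zₛ ⟩ j) ⟩
  (0ₚ +ₚ (1ₚ *ₚ [ k ]⟨ zₛ ⟩ j)) -ₚ ((sₛ *ₛ wₛ *ₛ zₛ) 1 *ₚ [ k ]⟨ wₛ *ₛ zₛ ⟩ j)
    ≈⟨ -ₚ-cong (≋-trans (+ₚ-identityˡ _) (*ₚ-identityˡ ([ k ]⟨ zₛ ⟩ j))) (*ₚ-cong swz-coeff (≋-refl {[ k ]⟨ wₛ *ₛ zₛ ⟩ j})) ⟩
  [ k ]⟨ zₛ ⟩ j -ₚ (monomial 1 1 *ₚ [ k ]⟨ wₛ *ₛ zₛ ⟩ j)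
    ≈⟨ -ₚ-cong (Z.q-integer-coeff ≋-refl k j)
               (≋-trans (monomial-*ₚ 1 1 _) (≋-cong sw-lin (WZ.q-integer-coeff wz-coeff k j))) ⟩
  [ j <ᵇ k ]· monomial 0 (j ℕ.* 0) -ₚ s^ 1 · w^ 1 · [ j <ᵇ k ]· monomial 0 (j ℕ.* 1)
    ≈⟨ -ₚ-cong ([]·-cong (j <ᵇ k) (λ _ → ≡⇒≋ (cong (monomial 0) (ℕ.*-zeroʳ j))))
               ([]·-commute sw-lin (j <ᵇ k) _) ⟩
  [ j <ᵇ k ]· 1ₚ -ₚ [ j <ᵇ k ]· s^ 1 · w^ 1 · monomial 0 (j ℕ.* 1)
    ≈⟨ ≋-sym (-ₚ-homo ([]·-linear (j <ᵇ k)) 1ₚ _) ⟩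
  [ j <ᵇ k ]· (1ₚ -ₚ s^ 1 · w^ 1 · w^ (j ℕ.* 1) · 1ₚ)
    ≈⟨ []·-cong (j <ᵇ k) (λ _ → -ₚ-cong (≋-refl {1ₚ}) (≋-cong (s^-linear 1)
         (≋-trans (w^-+ 1 (j ℕ.* 1) 1ₚ) (≡⇒≋ (cong (λ e → w^ suc e · 1ₚ) (ℕ.*-identityʳ j)))))) ⟩
  [ j <ᵇ k ]· (1ₚ -ₚ monomial 1 (suc j)) ∎
  where
  module Z = DegreeOne zₛ-homogeneous
  module WZ = DegreeOne (*ₛ-homogeneous-+ wₛ-homogeneous zₛ-homogeneous)
  module SWZ = DegreeOne (*ₛ-homogeneous-+ (*ₛ-homogeneous-+ sₛ-homogeneous wₛ-homogeneous) zₛ-homogeneous)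
  sw-lin : IsLinear (λ p → s^ 1 · w^ 1 · p)
  sw-lin = ∘-linear (s^-linear 1) (w^-linear 1)

invTable-stable : ∀ F n j → j ≤ n → invTable F n j ≡ inv F j
invTable-stable F zero    .zero z≤n = refl
invTable-stable F (suc n) j j≤1+n with j ℕ.≟ suc n
... | yes refl = refl
... | no j≢1+n with j ℕ.≤ᵇ n | ℕ.≤⇒≤ᵇ (≤-pred (≤∧≢⇒< j≤1+n j≢1+n))
...   | true | _ = invTable-stable F n j (≤-pred (≤∧≢⇒< j≤1+n j≢1+n))

<ᵇ-irrefl : ∀ n → (n <ᵇ n) ≡ false
<ᵇ-irrefl zero    = refl
<ᵇ-irrefl (suc n) = <ᵇ-irrefl n

inv-suc : ∀ F n → inv F (suc n) ≋ (0ₚ -ₚ Σ≤ₚ n (λ i → F (suc i) *ₚ inv F (n ∸ i)))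
inv-suc F n rewrite <ᵇ-irrefl n =
  -ₚ-cong (≋-refl {0ₚ})
    (Σ≤ₚ-cong n (λ i _ → *ₚ-cong (≋-refl {F (suc i)}) (≡⇒≋ (invTable-stable F n (n ∸ i) (m∸n≤m n i)))))

inv-suc-neg : ∀ F (X : ℕ → Poly) → (∀ i → F (suc i) ≋ -ₚ X i) →
              ∀ n → inv F (suc n) ≋ Σ≤ₚ n (λ i → X i *ₚ inv F (n ∸ i))
inv-suc-neg F X F≋-X n = begin
  inv F (suc n)                                              ≈⟨ inv-suc F n ⟩
  0ₚ -ₚ Σ≤ₚ n (λ i → F (suc i) *ₚ inv F (n ∸ i))            ≈⟨ -ₚ-cong (≋-refl {0ₚ}) (Σ≤ₚ-cong n term) ⟩
  0ₚ -ₚ Σ≤ₚ n (λ i → -ₚ (X i *ₚ inv F (n ∸ i)))              ≈⟨ -ₚ-cong (≋-refl {0ₚ}) (Σ≤ₚ-neg n _) ⟩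
  0ₚ -ₚ (-ₚ Σ≤ₚ n (λ i → X i *ₚ inv F (n ∸ i)))              ≈⟨ (λ a b → 0-neg (Σ≤ₚ n (λ i → X i *ₚ inv F (n ∸ i)) a b)) ⟩
  Σ≤ₚ n (λ i → X i *ₚ inv F (n ∸ i))                         ∎
  where
  term : ∀ i → i ≤ n → F (suc i) *ₚ inv F (n ∸ i) ≋ -ₚ (X i *ₚ inv F (n ∸ i))
  term i _ = ≋-trans (*ₚ-cong (F≋-X i) (≋-refl {inv F (n ∸ i)})) (-ₚ-distribˡ-*ₚ (X i) (inv F (n ∸ i)))
  0-neg : ∀ x → 0ℤ - (- x) ≡ x
  0-neg = solve-∀

mark : ℕ → Poly → Poly
mark i X = s^ 1 · w^ i · X -ₚ X

mark-linear : ∀ i → IsLinear (mark i)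
mark-linear i = record
  { ≋-cong = λ p≋q → -ₚ-cong (≋-cong sw-lin p≋q) p≋q
  ; +ₚ-homo = λ p q a b → trans (cong (_- (p a b + q a b)) (+ₚ-homo sw-lin p q a b))
                                  (interchange ((s^ 1 · w^ i · p) a b) ((s^ 1 · w^ i · q) a b) (p a b) (q a b))
  ; 0ₚ-homo = λ a b → cong (_- 0ℤ) (0ₚ-homo sw-lin a b)
  }
  where
  sw-lin : IsLinear (λ p → s^ 1 · w^ i · p)
  sw-lin = ∘-linear (s^-linear 1) (w^-linear i)
  interchange : ∀ x y z v → (x + y) - (z + v) ≡ (x - z) + (y - v)
  interchange = solve-∀

mark-*ₚ : ∀ i p q → mark i (p *ₚ q) ≋ (mark i p *ₚ q)
mark-*ₚ i p q = ≋-sym (begin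
  (s^ 1 · w^ i · p -ₚ p) *ₚ q                 ≈⟨ -ₚ-homo (*ₚ-linearˡ q) (s^ 1 · w^ i · p) p ⟩
  ((s^ 1 · w^ i · p) *ₚ q) -ₚ (p *ₚ q)        ≈⟨ -ₚ-cong (≋-trans (s^-*ₚ 1 _ q) (≋-cong (s^-linear 1) (w^-*ₚ i p q)))
                                                         (≋-refl {p *ₚ q}) ⟩
  s^ 1 · w^ i · (p *ₚ q) -ₚ (p *ₚ q)          ∎)

-- A valley of depth v hanging from a peak at height k stays above the axis iff v ≤ k; this cut-off
-- is where the q-integers [k] come from.
markValley : ℕ → ℕ → Poly → Poly
markValley k v p = [ v <ᵇ suc k ]· mark v p

markValley-linear : ∀ k v → IsLinear (markValley k v)
markValley-linear k v = ∘-linear ([]·-linear (v <ᵇ suc k)) (mark-linear v)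

markValley-*ₚ : ∀ k v p q → markValley k v (p *ₚ q) ≋ (markValley k v p *ₚ q)
markValley-*ₚ k v p q =
  ≋-trans ([]·-cong (v <ᵇ suc k) (λ _ → mark-*ₚ v p q)) (≋-sym ([]·-commute (*ₚ-linearˡ q) (v <ᵇ suc k) (mark v p)))

H : ℕ → Series
H k = inv (B k)

H-suc : ∀ k t → H k (suc t) ≋ Σ≤ₚ t (λ i → markValley k (suc i) (H k (t ∸ i)))
H-suc k t = ≋-trans (inv-suc-neg (B k) X B≋-X t) (Σ≤ₚ-cong t (λ i _ → term i))
  where
  X : ℕ → Poly
  X i = [ i <ᵇ k ]· (monomial 1 (suc i) -ₚ 1ₚ)
  B≋-X : ∀ i → B k (suc i) ≋ -ₚ X i
  B≋-X i = ≋-trans (B-suc k i) (≋-trans ([]·-cong (i <ᵇ k) (λ _ a b → flip (1ₚ a b) _))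
                                         (≋-sym ([]·-commute neg-linear (i <ᵇ k) _)))
    where
    flip : ∀ x y → x - y ≡ - (y - x)
    flip = solve-∀
    neg-linear : IsLinear (λ p → -ₚ p)
    neg-linear = record { ≋-cong = λ p≋q a b → cong -_ (p≋q a b)
                        ; +ₚ-homo = λ p q a b → ℤ.neg-distrib-+ (p a b) (q a b)
                        ; 0ₚ-homo = λ a b → refl }
  term : ∀ i → X i *ₚ H k (t ∸ i) ≋ markValley k (suc i) (H k (t ∸ i))
  term i = ≋-trans ([]·-commute (*ₚ-linearˡ (H k (t ∸ i))) (i <ᵇ k) _)
                   ([]·-cong (i <ᵇ k) (λ _ → ≋-trans (-ₚ-homo (*ₚ-linearˡ (H k (t ∸ i))) (monomial 1 (suc i)) 1ₚ)
                      (-ₚ-cong (monomial-*ₚ 1 (suc i) _) (*ₚ-identityˡ (H k (t ∸ i))))))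

H₊ : ℕ → Series
H₊ k i = H k i -ₚ [ i ≡ᵇ 0 ]· 1ₚ

zₛ-suc : ∀ i → zₛ (suc i) ≋ [ i ≡ᵇ 0 ]· 1ₚ
zₛ-suc zero    = ≋-refl
zₛ-suc (suc i) = ≋-refl

Gtrunc-suc : ∀ M k n → Gtrunc (suc M) k (suc n) ≋
             Σ≤ₚ n (λ i → (H₊ k i +ₚ Gtrunc M (suc k) i) *ₚ Gtrunc (suc M) k (n ∸ i))
Gtrunc-suc M k = inv-suc-neg _ (λ i → H₊ k i +ₚ Gtrunc M (suc k) i) coeff
  where
  module Z = DegreeOne zₛ-homogeneous
  rearrange : ∀ e h y → ((0ℤ + e) - h) - y ≡ - ((h - e) + y)
  rearrange = solve-∀
  coeff : ∀ i → (1ₛ +ₛ zₛ -ₛ zₛ *ₛ H k -ₛ zₛ *ₛ Gtrunc M (suc k)) (suc i) ≋ -ₚ (H₊ k i +ₚ Gtrunc M (suc k) i)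
  coeff i a b = trans (cong₂ _-_ (cong₂ _-_ (cong (λ e → 0ℤ + e) (zₛ-suc i a b))
                                            (trans (Z.*ₛ-suc (H k) i a b) (*ₚ-identityˡ (H k i) a b)))
                                 (trans (Z.*ₛ-suc (Gtrunc M (suc k)) i a b) (*ₚ-identityˡ (Gtrunc M (suc k) i) a b)))
                      (rearrange (([ i ≡ᵇ 0 ]· 1ₚ) a b) (H k i a b) (Gtrunc M (suc k) i a b))

sumWords : ℕ → (List Step → Poly) → Poly
sumWords zero    F = F []
sumWords (suc m) F = sumWords m (λ w → F (u ∷ w) +ₚ F (d ∷ w))

sumWords-cong : ∀ m {F G} → (∀ w → F w ≋ G w) → sumWords m F ≋ sumWords m G
sumWords-cong zero    F≋G = F≋G []
sumWords-cong (suc m) F≋G = sumWords-cong m (λ w → +ₚ-cong (F≋G (u ∷ w)) (F≋G (d ∷ w)))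

sumWords-commute : ∀ {L} → IsLinear L → ∀ m F → L (sumWords m F) ≋ sumWords m (L ∘ F)
sumWords-commute L-lin zero    F = ≋-refl
sumWords-commute L-lin (suc m) F =
  ≋-trans (sumWords-commute L-lin m _) (sumWords-cong m (λ w → +ₚ-homo L-lin (F (u ∷ w)) (F (d ∷ w))))

sumWords-+ : ∀ m F G → sumWords m (λ w → F w +ₚ G w) ≋ (sumWords m F +ₚ sumWords m G)
sumWords-+ zero    F G = ≋-refl
sumWords-+ (suc m) F G =
  ≋-trans (sumWords-cong m (λ w a b → interchange (F (u ∷ w) a b) (G (u ∷ w) a b) (F (d ∷ w) a b) (G (d ∷ w) a b)))
          (sumWords-+ m _ _)
  where
  interchange : ∀ p q r s → p + q + (r + s) ≡ p + r + (q + s)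
  interchange = solve-∀

sumWords-zero : ∀ m F → (∀ w → length w ≡ m → F w ≋ 0ₚ) → sumWords m F ≋ 0ₚ
sumWords-zero zero    F F≋0 = F≋0 [] refl
sumWords-zero (suc m) F F≋0 =
  sumWords-zero m _ (λ w |w|≡m → ≋-trans (+ₚ-cong (F≋0 (u ∷ w) (cong suc |w|≡m)) (F≋0 (d ∷ w) (cong suc |w|≡m)))
                                         (+ₚ-identityʳ 0ₚ))

sumWords-*ₚ : ∀ a b F G → sumWords a (λ x → sumWords b (λ y → F x *ₚ G y)) ≋ (sumWords a F *ₚ sumWords b G)
sumWords-*ₚ a b F G =
  ≋-trans (sumWords-cong a (λ x → ≋-sym (sumWords-commute (*ₚ-linearʳ (F x)) b G)))
          (≋-sym (sumWords-commute (*ₚ-linearˡ (sumWords b G)) a F))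

sumPairs : ℕ → (List Step → List Step → Poly) → Poly
sumPairs m g = Σ≤ₚ m (λ a → sumWords a (λ x → sumWords (m ∸ a) (g x)))

sumPairs-suc : ∀ m g → sumPairs (suc m) g ≋
               (sumWords (suc m) (g []) +ₚ sumPairs m (λ x y → g (u ∷ x) y +ₚ g (d ∷ x) y))
sumPairs-suc m g =
  ≋-trans (Σ≤ₚ-suc-first m _)
          (+ₚ-cong (≋-refl {sumWords (suc m) (g [])})
                   (Σ≤ₚ-cong m (λ a _ → sumWords-cong a (λ x → ≋-sym (sumWords-+ (m ∸ a) (g (u ∷ x)) (g (d ∷ x)))))))

sumPairs-*ₚ : ∀ m F G → sumPairs m (λ x y → F x *ₚ G y) ≋ Σ≤ₚ m (λ a → sumWords a F *ₚ sumWords (m ∸ a) G)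
sumPairs-*ₚ m F G = Σ≤ₚ-cong m (λ a _ → sumWords-*ₚ a (m ∸ a) F G)

sumSplits : (List Step → List Step → Poly) → List Step → Poly
sumSplits g []      = g [] []
sumSplits g (x ∷ w) = g [] (x ∷ w) +ₚ sumSplits (λ c y → g (x ∷ c) y) w

sumDownSplits : (List Step → List Step → Poly) → List Step → Poly
sumDownSplits g []      = 0ₚ
sumDownSplits g (u ∷ w) = sumDownSplits (λ x y → g (u ∷ x) y) w
sumDownSplits g (d ∷ w) = g [] w +ₚ sumDownSplits (λ x y → g (d ∷ x) y) w

sumSplits-cong : ∀ w {g g′} → (∀ x y → g x y ≋ g′ x y) → sumSplits g w ≋ sumSplits g′ w
sumSplits-cong []      g≋g′ = g≋g′ [] []
sumSplits-cong (x ∷ w) g≋g′ = +ₚ-cong (g≋g′ [] (x ∷ w)) (sumSplits-cong w (λ c y → g≋g′ (x ∷ c) y))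

sumSplits-commute : ∀ {L} → IsLinear L → ∀ w g → L (sumSplits g w) ≋ sumSplits (λ x y → L (g x y)) w
sumSplits-commute L-lin []      g = ≋-refl
sumSplits-commute {L} L-lin (x ∷ w) g =
  ≋-trans (+ₚ-homo L-lin (g [] (x ∷ w)) _) (+ₚ-cong (≋-refl {L (g [] (x ∷ w))}) (sumSplits-commute L-lin w _))

sumSplits-+ : ∀ w g g′ → sumSplits (λ x y → g x y +ₚ g′ x y) w ≋ (sumSplits g w +ₚ sumSplits g′ w)
sumSplits-+ []      g g′ = ≋-refl
sumSplits-+ (x ∷ w) g g′ a b =
  trans (cong (λ r → g [] (x ∷ w) a b + g′ [] (x ∷ w) a b + r) (sumSplits-+ w _ _ a b))
        (interchange (g [] (x ∷ w) a b) (g′ [] (x ∷ w) a b) _ _)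
  where
  interchange : ∀ p q r s → p + q + (r + s) ≡ p + r + (q + s)
  interchange = solve-∀

sumSplits-zero : ∀ w g → (∀ x y → g x y ≋ 0ₚ) → sumSplits g w ≋ 0ₚ
sumSplits-zero []      g g≋0 = g≋0 [] []
sumSplits-zero (x ∷ w) g g≋0 =
  ≋-trans (+ₚ-cong (g≋0 [] (x ∷ w)) (sumSplits-zero w _ (λ c y → g≋0 (x ∷ c) y))) (+ₚ-identityʳ 0ₚ)

sumDownSplits-cong : ∀ w {g g′} → (∀ x y → g x y ≋ g′ x y) → sumDownSplits g w ≋ sumDownSplits g′ w
sumDownSplits-cong []      g≋g′ = ≋-refl
sumDownSplits-cong (u ∷ w) g≋g′ = sumDownSplits-cong w (λ x y → g≋g′ (u ∷ x) y)
sumDownSplits-cong (d ∷ w) g≋g′ = +ₚ-cong (g≋g′ [] w) (sumDownSplits-cong w (λ x y → g≋g′ (d ∷ x) y))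

sumDownSplits-commute : ∀ {L} → IsLinear L → ∀ w g → L (sumDownSplits g w) ≋ sumDownSplits (λ x y → L (g x y)) w
sumDownSplits-commute L-lin []      g = 0ₚ-homo L-lin
sumDownSplits-commute L-lin (u ∷ w) g = sumDownSplits-commute L-lin w _
sumDownSplits-commute {L} L-lin (d ∷ w) g =
  ≋-trans (+ₚ-homo L-lin (g [] w) _) (+ₚ-cong (≋-refl {L (g [] w)}) (sumDownSplits-commute L-lin w _))

sumDownSplits-+ : ∀ w g g′ → sumDownSplits (λ x y → g x y +ₚ g′ x y) w ≋ (sumDownSplits g w +ₚ sumDownSplits g′ w)
sumDownSplits-+ []      g g′ a b = refl
sumDownSplits-+ (u ∷ w) g g′ = sumDownSplits-+ w _ _
sumDownSplits-+ (d ∷ w) g g′ a b =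
  trans (cong (λ r → g [] w a b + g′ [] w a b + r) (sumDownSplits-+ w _ _ a b))
        (interchange (g [] w a b) (g′ [] w a b) _ _)
  where
  interchange : ∀ p q r s → p + q + (r + s) ≡ p + r + (q + s)
  interchange = solve-∀

sumDownSplits-zero : ∀ w g → (∀ x y → g x y ≋ 0ₚ) → sumDownSplits g w ≋ 0ₚ
sumDownSplits-zero []      g g≋0 = ≋-refl
sumDownSplits-zero (u ∷ w) g g≋0 = sumDownSplits-zero w _ (λ x y → g≋0 (u ∷ x) y)
sumDownSplits-zero (d ∷ w) g g≋0 =
  ≋-trans (+ₚ-cong (g≋0 [] w) (sumDownSplits-zero w _ (λ x y → g≋0 (d ∷ x) y))) (+ₚ-identityʳ 0ₚ)

sumWords-sumSplits : ∀ m g → sumWords m (sumSplits g) ≋ sumPairs m g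
sumWords-sumSplits zero    g = ≋-refl
sumWords-sumSplits (suc m) g = begin
  sumWords m (λ w → (g [] (u ∷ w) +ₚ sumSplits gu w) +ₚ (g [] (d ∷ w) +ₚ sumSplits gd w))
    ≈⟨ sumWords-cong m (λ w a b → interchange (g [] (u ∷ w) a b) _ (g [] (d ∷ w) a b) _) ⟩
  sumWords m (λ w → (g [] (u ∷ w) +ₚ g [] (d ∷ w)) +ₚ (sumSplits gu w +ₚ sumSplits gd w))
    ≈⟨ sumWords-+ m _ _ ⟩
  sumWords (suc m) (g []) +ₚ sumWords m (λ w → sumSplits gu w +ₚ sumSplits gd w)
    ≈⟨ +ₚ-cong (≋-refl {sumWords (suc m) (g [])})
               (≋-trans (sumWords-cong m (λ w → ≋-sym (sumSplits-+ w gu gd))) (sumWords-sumSplits m _)) ⟩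
  sumWords (suc m) (g []) +ₚ sumPairs m (λ x y → gu x y +ₚ gd x y)
    ≈⟨ ≋-sym (sumPairs-suc m g) ⟩
  sumPairs (suc m) g ∎
  where
  gu gd : List Step → List Step → Poly
  gu x y = g (u ∷ x) y
  gd x y = g (d ∷ x) y
  interchange : ∀ p q r s → p + q + (r + s) ≡ p + r + (q + s)
  interchange = solve-∀

sumWords-sumDownSplits : ∀ m g → sumWords (suc m) (sumDownSplits g) ≋ sumPairs m g
sumWords-sumDownSplits m g = begin
  sumWords m (λ w → sumDownSplits gu w +ₚ (g [] w +ₚ sumDownSplits gd w))
    ≈⟨ sumWords-cong m (λ w a b → rearrange (sumDownSplits gu w a b) (g [] w a b) (sumDownSplits gd w a b)) ⟩
  sumWords m (λ w → g [] w +ₚ (sumDownSplits gu w +ₚ sumDownSplits gd w))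
    ≈⟨ sumWords-+ m _ _ ⟩
  sumWords m (g []) +ₚ sumWords m (λ w → sumDownSplits gu w +ₚ sumDownSplits gd w)
    ≈⟨ +ₚ-cong (≋-refl {sumWords m (g [])}) (sumWords-cong m (λ w → ≋-sym (sumDownSplits-+ w gu gd))) ⟩
  sumWords m (g []) +ₚ sumWords m (sumDownSplits (λ x y → gu x y +ₚ gd x y))
    ≈⟨ tail m ⟩
  sumPairs m g ∎
  where
  gu gd : List Step → List Step → Poly
  gu x y = g (u ∷ x) y
  gd x y = g (d ∷ x) y
  rearrange : ∀ p q r → p + (q + r) ≡ q + (p + r)
  rearrange = solve-∀
  tail : ∀ m → (sumWords m (g []) +ₚ sumWords m (sumDownSplits (λ x y → gu x y +ₚ gd x y))) ≋ sumPairs m g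
  tail zero    = +ₚ-identityʳ (g [] [])
  tail (suc m) = ≋-trans (+ₚ-cong (≋-refl {sumWords (suc m) (g [])}) (sumWords-sumDownSplits m _))
                         (≋-sym (sumPairs-suc m g))

-- Signed walks with marked valleys

data Tail : Set where
  endsWord   : Tail
  walksAbove : ℕ → Tail

-- walk f h w is the signed weight of w read from height h down to height f, staying at height ≥ f
-- outside marked chains. A chain starts after an up step from height h: chainDown has read d^(i+1)
-- of its current valley, chainUp v j still needs j up steps to close a valley of depth v, and the
-- tail says what follows the chain once it is back at height h.
mutual
  walk : ℕ → ℕ → List Step → Poly
  walk f h       []      = [ h ≡ᵇ f ]· 1ₚ
  walk f h       (u ∷ w) = walk f (suc h) w +ₚ chain (walksAbove f) h w
  walk f zero    (d ∷ w) = 0ₚ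
  walk f (suc h) (d ∷ w) = [ f <ᵇ suc h ]· walk f h w

  chain : Tail → ℕ → List Step → Poly
  chain t h []      = 0ₚ
  chain t h (u ∷ w) = 0ₚ
  chain t h (d ∷ w) = chainDown t h 0 w

  chainDown : Tail → ℕ → ℕ → List Step → Poly
  chainDown t h i []      = 0ₚ
  chainDown t h i (d ∷ w) = chainDown t h (suc i) w
  chainDown t h i (u ∷ w) = chainUp t h (suc i) i w

  chainUp : Tail → ℕ → ℕ → ℕ → List Step → Poly
  chainUp t h v j       []      = 0ₚ
  chainUp t h v (suc j) (u ∷ w) = chainUp t h v j w
  chainUp t h v (suc j) (d ∷ w) = 0ₚ
  chainUp t h v zero    (u ∷ w) = 0ₚ
  chainUp t h v zero    (d ∷ w) = markValley (suc h) v (chainDown t h 0 w +ₚ tail t h w)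

  tail : Tail → ℕ → List Step → Poly
  tail endsWord       h []      = 1ₚ
  tail endsWord       h (_ ∷ _) = 0ₚ
  tail (walksAbove f) h w       = walk f h w

-- the parity of the length of a tail with nonzero weight
tailParity : Tail → ℕ → Bool
tailParity endsWord       h = false
tailParity (walksAbove f) h = odd (h ⊕ f)

mutual
  walk-parity : ∀ w f h → odd (length w) ≡ not (odd (h ⊕ f)) → walk f h w ≋ 0ₚ
  walk-parity [] f h odd≡ with h ℕ.≟ f
  ... | yes refl = ⊥-elim (not-¬ refl (trans odd≡ (cong not (odd-double h))))
  ... | no  h≢f  = []·-false 1ₚ (h≢f ∘ ℕ.≡ᵇ⇒≡ h f)
  walk-parity (u ∷ w) f h odd≡ =
    ≋-trans (+ₚ-cong (walk-parity w f (suc h) (trans L≡ (sym (not-involutive _))))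
                     (chain-parity w (walksAbove f) h L≡))
            (+ₚ-identityʳ 0ₚ)
    where L≡ = not-injective odd≡
  walk-parity (d ∷ w) f zero    odd≡ = ≋-refl
  walk-parity (d ∷ w) f (suc h) odd≡ =
    vanishes ([]·-linear (f <ᵇ suc h)) (walk-parity w f h (not-injective odd≡))

  chain-parity : ∀ w t h → odd (length w) ≡ tailParity t h → chain t h w ≋ 0ₚ
  chain-parity []      t h _    = ≋-refl
  chain-parity (u ∷ w) t h _    = ≋-refl
  chain-parity (d ∷ w) t h odd≡ = chainDown-parity w t h 0 (not-swap odd≡)

  chainDown-parity : ∀ w t h i → odd (i ⊕ length w) ≡ not (tailParity t h) → chainDown t h i w ≋ 0ₚ
  chainDown-parity []      t h i _    = ≋-refl
  chainDown-parity (d ∷ w) t h i odd≡ =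
    chainDown-parity w t h (suc i) (trans (sym (odd-+-suc i (length w))) odd≡)
  chainDown-parity (u ∷ w) t h i odd≡ =
    chainUp-parity w t h (suc i) i (not-injective (trans (sym (odd-+-suc i (length w))) odd≡))

  chainUp-parity : ∀ w t h v j → odd (j ⊕ length w) ≡ tailParity t h → chainUp t h v j w ≋ 0ₚ
  chainUp-parity []      t h v j       _    = ≋-refl
  chainUp-parity (u ∷ w) t h v (suc j) odd≡ =
    chainUp-parity w t h v j (trans (sym (not-involutive _)) (trans (cong not (sym (odd-+-suc j (length w)))) odd≡))
  chainUp-parity (d ∷ w) t h v (suc j) _    = ≋-refl
  chainUp-parity (u ∷ w) t h v zero    _    = ≋-refl
  chainUp-parity (d ∷ w) t h v zero    odd≡ =
    vanishes (markValley-linear (suc h) v)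
      (≋-trans (+ₚ-cong (chainDown-parity w t h 0 (not-swap odd≡)) (tail-parity w t h (not-swap odd≡)))
               (+ₚ-identityʳ 0ₚ))

  tail-parity : ∀ w t h → odd (length w) ≡ not (tailParity t h) → tail t h w ≋ 0ₚ
  tail-parity []      endsWord       h ()
  tail-parity (_ ∷ w) endsWord       h _    = ≋-refl
  tail-parity w       (walksAbove f) h odd≡ = walk-parity w f h odd≡

module FirstPassage (f g : ℕ) (f≤g : f ≤ g) where

  Split : (List Step → Poly) → List Step → Poly
  Split P = sumDownSplits (λ x y → P x *ₚ walk f g y)

  Split-vanishes : ∀ w {P} → (∀ x → P x ≋ 0ₚ) → Split P w ≋ 0ₚ
  Split-vanishes w P≋0 = sumDownSplits-zero w _ (λ x y → vanishes (*ₚ-linearˡ (walk f g y)) (P≋0 x))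

  Split-zero : ∀ w → Split (λ _ → 0ₚ) w ≋ 0ₚ
  Split-zero w = Split-vanishes w (λ _ → ≋-refl)

  head-zero : ∀ (P : List Step → Poly) w → P [] ≋ 0ₚ → Split P (d ∷ w) ≋ Split (P ∘ (d ∷_)) w
  head-zero P w P[]≋0 =
    ≋-trans (+ₚ-cong (≋-trans (*ₚ-cong P[]≋0 (≋-refl {walk f g w})) (*ₚ-zeroˡ (walk f g w)))
                     (≋-refl {Split (P ∘ (d ∷_)) w}))
            (+ₚ-identityˡ _)

  mutual
    walk-firstPassage : ∀ w h → g < h → walk f h w ≋ Split (walk (suc g) h) w
    walk-firstPassage []      h g<h = []·-false 1ₚ (λ h≡ᵇf → <⇒≱ g<h (subst (_≤ g) (sym (ℕ.≡ᵇ⇒≡ h f h≡ᵇf)) f≤g))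
    walk-firstPassage (u ∷ w) h g<h =
      ≋-trans (+ₚ-cong (walk-firstPassage w (suc h) (m≤n⇒m≤1+n g<h)) (chain-firstPassage w h g<h))
              (≋-trans (≋-sym (sumDownSplits-+ w _ _))
                       (sumDownSplits-cong w (λ x y → ≋-sym (*ₚ-distribʳ-+ₚ (walk (suc g) (suc h) x) _ (walk f g y)))))
    walk-firstPassage (d ∷ w) (suc h) (s≤s g≤h) with g ℕ.≟ h
    ... | yes refl = ≋-sym (begin
      Split (walk (suc g) (suc g)) (d ∷ w)
        ≈⟨ +ₚ-cong (*ₚ-cong ([]·-true 1ₚ (ℕ.≡⇒≡ᵇ g g refl)) (≋-refl {walk f g w}))
                   (Split-vanishes w (λ _ → []·-false _ (<-irrefl refl ∘ ℕ.<ᵇ⇒< g g))) ⟩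
      (1ₚ *ₚ walk f g w) +ₚ 0ₚ
        ≈⟨ ≋-trans (+ₚ-identityʳ _) (*ₚ-identityˡ (walk f g w)) ⟩
      walk f g w
        ≈⟨ ≋-sym ([]·-true _ (ℕ.<⇒<ᵇ (s≤s f≤g))) ⟩
      [ f <ᵇ suc g ]· walk f g w ∎)
    ... | no g≢h = begin
      [ f <ᵇ suc h ]· walk f h w                       ≈⟨ []·-true _ (ℕ.<⇒<ᵇ (s≤s (≤-trans f≤g g≤h))) ⟩
      walk f h w                                       ≈⟨ walk-firstPassage w h g<h ⟩
      Split (walk (suc g) h) w                         ≈⟨ sumDownSplits-cong w (λ x y →
                                                            *ₚ-cong (≋-sym ([]·-true _ (ℕ.<⇒<ᵇ g<h))) (≋-refl {walk f g y})) ⟩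
      Split (walk (suc g) (suc h) ∘ (d ∷_)) w          ≈⟨ ≋-sym (head-zero (walk (suc g) (suc h)) w
                                                            ([]·-false 1ₚ (g≢h ∘ sym ∘ ℕ.suc-injective ∘ ℕ.≡ᵇ⇒≡ (suc h) (suc g)))) ⟩
      Split (walk (suc g) (suc h)) (d ∷ w)             ∎
      where g<h = ≤∧≢⇒< g≤h g≢h

    chain-firstPassage : ∀ w h → g < h → chain (walksAbove f) h w ≋ Split (chain (walksAbove (suc g)) h) w
    chain-firstPassage []      h g<h = ≋-refl
    chain-firstPassage (u ∷ w) h g<h = ≋-sym (Split-zero w)
    chain-firstPassage (d ∷ w) h g<h =
      ≋-trans (chainDown-firstPassage w h 0 g<h) (≋-sym (head-zero (chain (walksAbove (suc g)) h) w ≋-refl))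

    chainDown-firstPassage : ∀ w h i → g < h →
                             chainDown (walksAbove f) h i w ≋ Split (chainDown (walksAbove (suc g)) h i) w
    chainDown-firstPassage []      h i g<h = ≋-refl
    chainDown-firstPassage (d ∷ w) h i g<h =
      ≋-trans (chainDown-firstPassage w h (suc i) g<h) (≋-sym (head-zero (chainDown (walksAbove (suc g)) h i) w ≋-refl))
    chainDown-firstPassage (u ∷ w) h i g<h = chainUp-firstPassage w h (suc i) i g<h

    chainUp-firstPassage : ∀ w h v j → g < h →
                           chainUp (walksAbove f) h v j w ≋ Split (chainUp (walksAbove (suc g)) h v j) w
    chainUp-firstPassage []      h v j       g<h = ≋-refl
    chainUp-firstPassage (u ∷ w) h v (suc j) g<h = chainUp-firstPassage w h v j g<h
    chainUp-firstPassage (u ∷ w) h v zero    g<h = ≋-sym (Split-zero w)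
    chainUp-firstPassage (d ∷ w) h v (suc j) g<h =
      ≋-sym (≋-trans (head-zero (chainUp (walksAbove (suc g)) h v (suc j)) w ≋-refl) (Split-zero w))
    chainUp-firstPassage (d ∷ w) h v zero    g<h = begin
      L (chainDown (walksAbove f) h 0 w +ₚ walk f h w)
        ≈⟨ ≋-cong L-lin (+ₚ-cong (chainDown-firstPassage w h 0 g<h) (walk-firstPassage w h g<h)) ⟩
      L (Split (chainDown (walksAbove (suc g)) h 0) w +ₚ Split (walk (suc g) h) w)
        ≈⟨ ≋-cong L-lin (≋-sym (sumDownSplits-+ w _ _)) ⟩
      L (sumDownSplits (λ x y → (chainDown (walksAbove (suc g)) h 0 x *ₚ walk f g y) +ₚ (walk (suc g) h x *ₚ walk f g y)) w)
        ≈⟨ sumDownSplits-commute L-lin w _ ⟩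
      sumDownSplits (λ x y → L ((chainDown (walksAbove (suc g)) h 0 x *ₚ walk f g y) +ₚ (walk (suc g) h x *ₚ walk f g y))) w
        ≈⟨ sumDownSplits-cong w (λ x y →
             ≋-trans (≋-cong L-lin (≋-sym (*ₚ-distribʳ-+ₚ (chainDown (walksAbove (suc g)) h 0 x) _ (walk f g y))))
                     (markValley-*ₚ (suc h) v _ (walk f g y))) ⟩
      Split (λ x → L (chainDown (walksAbove (suc g)) h 0 x +ₚ walk (suc g) h x)) w
        ≈⟨ ≋-sym (head-zero (chainUp (walksAbove (suc g)) h v zero) w ≋-refl) ⟩
      Split (chainUp (walksAbove (suc g)) h v zero) (d ∷ w) ∎
      where
      L = markValley (suc h) v
      L-lin = markValley-linear (suc h) v

sumSplits-endsWord : ∀ h w (F : List Step → Poly) → sumSplits (λ c y → tail endsWord h c *ₚ F y) w ≋ F w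
sumSplits-endsWord h []      F = *ₚ-identityˡ (F [])
sumSplits-endsWord h (x ∷ w) F =
  ≋-trans (+ₚ-cong (*ₚ-identityˡ (F (x ∷ w))) (sumSplits-zero w _ (λ c y → *ₚ-zeroˡ (F y))))
          (+ₚ-identityʳ (F (x ∷ w)))

module ChainFactor (f h : ℕ) where

  Split : (List Step → Poly) → List Step → Poly
  Split P = sumSplits (λ c y → P c *ₚ walk f h y)

  Split-zero : ∀ w → Split (λ _ → 0ₚ) w ≋ 0ₚ
  Split-zero w = sumSplits-zero w _ (λ c y → *ₚ-zeroˡ (walk f h y))

  head-zero : ∀ (P : List Step → Poly) x w → P [] ≋ 0ₚ → Split P (x ∷ w) ≋ Split (P ∘ (x ∷_)) w
  head-zero P x w P[]≋0 =
    ≋-trans (+ₚ-cong (≋-trans (*ₚ-cong P[]≋0 (≋-refl {walk f h (x ∷ w)})) (*ₚ-zeroˡ (walk f h (x ∷ w))))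
                     (≋-refl {Split (P ∘ (x ∷_)) w}))
            (+ₚ-identityˡ _)

  mutual
    chain-factor : ∀ w → chain (walksAbove f) h w ≋ Split (chain endsWord h) w
    chain-factor []      = ≋-sym (*ₚ-zeroˡ (walk f h []))
    chain-factor (u ∷ w) = ≋-sym (≋-trans (head-zero (chain endsWord h) u w ≋-refl) (Split-zero w))
    chain-factor (d ∷ w) = ≋-trans (chainDown-factor w 0) (≋-sym (head-zero (chain endsWord h) d w ≋-refl))

    chainDown-factor : ∀ w i → chainDown (walksAbove f) h i w ≋ Split (chainDown endsWord h i) w
    chainDown-factor []      i = ≋-sym (*ₚ-zeroˡ (walk f h []))
    chainDown-factor (d ∷ w) i =
      ≋-trans (chainDown-factor w (suc i)) (≋-sym (head-zero (chainDown endsWord h i) d w ≋-refl))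
    chainDown-factor (u ∷ w) i =
      ≋-trans (chainUp-factor w (suc i) i) (≋-sym (head-zero (chainDown endsWord h i) u w ≋-refl))

    chainUp-factor : ∀ w v j → chainUp (walksAbove f) h v j w ≋ Split (chainUp endsWord h v j) w
    chainUp-factor []      v j       = ≋-sym (*ₚ-zeroˡ (walk f h []))
    chainUp-factor (u ∷ w) v (suc j) =
      ≋-trans (chainUp-factor w v j) (≋-sym (head-zero (chainUp endsWord h v (suc j)) u w ≋-refl))
    chainUp-factor (u ∷ w) v zero    = ≋-sym (≋-trans (head-zero (chainUp endsWord h v zero) u w ≋-refl) (Split-zero w))
    chainUp-factor (d ∷ w) v (suc j) = ≋-sym (≋-trans (head-zero (chainUp endsWord h v (suc j)) d w ≋-refl) (Split-zero w))
    chainUp-factor (d ∷ w) v zero    = begin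
      L (chainDown (walksAbove f) h 0 w +ₚ walk f h w)
        ≈⟨ ≋-cong L-lin (+ₚ-cong (chainDown-factor w 0) (≋-sym (sumSplits-endsWord h w (walk f h)))) ⟩
      L (Split (chainDown endsWord h 0) w +ₚ Split (tail endsWord h) w)
        ≈⟨ ≋-cong L-lin (≋-sym (sumSplits-+ w _ _)) ⟩
      L (sumSplits (λ c y → (chainDown endsWord h 0 c *ₚ walk f h y) +ₚ (tail endsWord h c *ₚ walk f h y)) w)
        ≈⟨ sumSplits-commute L-lin w _ ⟩
      sumSplits (λ c y → L ((chainDown endsWord h 0 c *ₚ walk f h y) +ₚ (tail endsWord h c *ₚ walk f h y))) w
        ≈⟨ sumSplits-cong w (λ c y →
             ≋-trans (≋-cong L-lin (≋-sym (*ₚ-distribʳ-+ₚ (chainDown endsWord h 0 c) _ (walk f h y))))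
                     (markValley-*ₚ (suc h) v _ (walk f h y))) ⟩
      Split (λ c → L (chainDown endsWord h 0 c +ₚ tail endsWord h c)) w
        ≈⟨ ≋-sym (head-zero (chainUp endsWord h v zero) d w ≋-refl) ⟩
      Split (chainUp endsWord h v zero) (d ∷ w) ∎
      where
      L = markValley (suc h) v
      L-lin = markValley-linear (suc h) v

module ChainSum (h : ℕ) where

  Down : ℕ → ℕ → Poly
  Down i m = sumWords m (chainDown endsWord h i)

  Up : ℕ → ℕ → ℕ → Poly
  Up v j m = sumWords m (chainUp endsWord h v j)

  End : ℕ → Poly
  End m = sumWords m (tail endsWord h)

  End-eval : ∀ m → End m ≋ [ m ≡ᵇ 0 ]· 1ₚ
  End-eval zero    = ≋-refl
  End-eval (suc m) = sumWords-zero m _ (λ w _ → +ₚ-identityʳ 0ₚ)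

  Down-suc : ∀ i m → Down i (suc m) ≋ (Up (suc i) i m +ₚ Down (suc i) m)
  Down-suc i m = sumWords-+ m (chainUp endsWord h (suc i) i) (chainDown endsWord h (suc i))

  Up-suc : ∀ v j m → Up v (suc j) (suc m) ≋ Up v j m
  Up-suc v j m = sumWords-cong m (λ w → +ₚ-identityʳ (chainUp endsWord h v j w))

  Up-zero : ∀ v m → Up v 0 (suc m) ≋ markValley (suc h) v (Down 0 m +ₚ End m)
  Up-zero v m = begin
    sumWords m (λ w → 0ₚ +ₚ L (chainDown endsWord h 0 w +ₚ tail endsWord h w))
      ≈⟨ sumWords-cong m (λ w → +ₚ-identityˡ _) ⟩
    sumWords m (λ w → L (chainDown endsWord h 0 w +ₚ tail endsWord h w))
      ≈⟨ ≋-sym (sumWords-commute L-lin m _) ⟩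
    L (sumWords m (λ w → chainDown endsWord h 0 w +ₚ tail endsWord h w))
      ≈⟨ ≋-cong L-lin (sumWords-+ m _ _) ⟩
    L (Down 0 m +ₚ End m) ∎
    where
    L = markValley (suc h) v
    L-lin = markValley-linear (suc h) v

  Up-shift : ∀ v j r → Up v j (j ⊕ r) ≋ Up v 0 r
  Up-shift v zero    r = ≋-refl
  Up-shift v (suc j) r = ≋-trans (Up-suc v j (j ⊕ r)) (Up-shift v j r)

  Up-short : ∀ v j m → m ≤ j → Up v j m ≋ 0ₚ
  Up-short v j       zero    _         = ≋-refl
  Up-short v (suc j) (suc m) (s≤s m≤j) = ≋-trans (Up-suc v j m) (Up-short v j m m≤j)

  Down-expand : ∀ i m → Down i m ≋ Σ≤ₚ m (λ e → Up (suc (i ⊕ e)) (i ⊕ e) (m ∸ suc e))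
  Down-expand i zero    = ≋-refl
  Down-expand i (suc m) = begin
    Down i (suc m)
      ≈⟨ Down-suc i m ⟩
    Up (suc i) i m +ₚ Down (suc i) m
      ≈⟨ +ₚ-cong (≡⇒≋ (cong (λ n → Up (suc n) n m) (sym (+-identityʳ i)))) (Down-expand (suc i) m) ⟩
    Up (suc (i ⊕ 0)) (i ⊕ 0) m +ₚ Σ≤ₚ m (λ e → Up (suc (suc i ⊕ e)) (suc i ⊕ e) (m ∸ suc e))
      ≈⟨ +ₚ-cong (≋-refl {Up (suc (i ⊕ 0)) (i ⊕ 0) m})
                 (Σ≤ₚ-cong m (λ e _ → ≡⇒≋ (cong (λ n → Up (suc n) n (m ∸ suc e)) (sym (+-suc i e))))) ⟩
    Up (suc (i ⊕ 0)) (i ⊕ 0) m +ₚ Σ≤ₚ m (λ e → Up (suc (i ⊕ suc e)) (i ⊕ suc e) (m ∸ suc e))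
      ≈⟨ ≋-sym (Σ≤ₚ-suc-first m _) ⟩
    Σ≤ₚ (suc m) (λ e → Up (suc (i ⊕ e)) (i ⊕ e) (suc m ∸ suc e)) ∎

  -- Splitting off the first valley of a chain reproduces the recursion H-suc.
  chain-sum : ∀ t → sumWords (suc (t ⊕ t)) (chain endsWord h) ≋ H₊ (suc h) t
  chain-sum = <-rec (λ t → sumWords (suc (t ⊕ t)) (chain endsWord h) ≋ H₊ (suc h) t) step
    where
    step : ∀ t → (∀ {s} → s < t → sumWords (suc (s ⊕ s)) (chain endsWord h) ≋ H₊ (suc h) s) →
           sumWords (suc (t ⊕ t)) (chain endsWord h) ≋ H₊ (suc h) t
    step zero    _  a b = sym (ℤ.+-inverseʳ (1ₚ a b))
    step (suc t) IH = begin
      sumWords (suc M) (chain endsWord h)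
        ≈⟨ sumWords-cong M (λ w → +ₚ-identityˡ (chainDown endsWord h 0 w)) ⟩
      Down 0 M
        ≈⟨ Down-expand 0 M ⟩
      Σ≤ₚ M term
        ≈⟨ ≡⇒≋ (cong (λ n → Σ≤ₚ n term) (sym (+-suc t (suc t)))) ⟩
      Σ≤ₚ (t ⊕ suc (suc t)) term
        ≈⟨ Σ≤ₚ-truncate t (suc (suc t)) term
             (λ e t<e → Up-short (suc e) e (M ∸ suc e) (ℕ.m≤n+o⇒m∸n≤o M (suc e) (ℕ.+-mono-≤ (s≤s (<⇒≤ t<e)) t<e))) ⟩
      Σ≤ₚ t term
        ≈⟨ Σ≤ₚ-cong t (λ e e≤t → subst (λ t → ValleyTerm t e) (ℕ.m+[n∸m]≡n e≤t)
                                       (valley e (t ∸ e) (ℕ.≤-reflexive (ℕ.m+[n∸m]≡n e≤t)))) ⟩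
      Σ≤ₚ t (λ e → markValley (suc h) (suc e) (H (suc h) (t ∸ e)))
        ≈⟨ ≋-sym (H-suc (suc h) t) ⟩
      H (suc h) (suc t)
        ≈⟨ (λ a b → sym (ℤ.+-identityʳ _)) ⟩
      H₊ (suc h) (suc t) ∎
      where
      M = suc t ⊕ suc t
      term : ℕ → Poly
      term e = Up (suc e) e (M ∸ suc e)
      ValleyTerm : ℕ → ℕ → Set
      ValleyTerm t e = Up (suc e) e ((suc t ⊕ suc t) ∸ suc e) ≋ markValley (suc h) (suc e) (H (suc h) (t ∸ e))
      valley : ∀ e s → e ⊕ s ≤ t → ValleyTerm (e ⊕ s) e
      valley e s e+s≤t = begin
        Up (suc e) e ((suc (e ⊕ s) ⊕ suc (e ⊕ s)) ∸ suc e)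
          ≈⟨ ≡⇒≋ (cong (Up (suc e) e) (peak-offset e s)) ⟩
        Up (suc e) e (e ⊕ suc (s ⊕ s))
          ≈⟨ Up-shift (suc e) e (suc (s ⊕ s)) ⟩
        Up (suc e) 0 (suc (s ⊕ s))
          ≈⟨ Up-zero (suc e) (s ⊕ s) ⟩
        L (Down 0 (s ⊕ s) +ₚ End (s ⊕ s))
          ≈⟨ ≋-cong L-lin (+ₚ-cong (≋-trans (≋-sym (sumWords-cong (s ⊕ s) (λ w → +ₚ-identityˡ _)))
                                            (IH (s≤s (≤-trans (ℕ.m≤n+m s e) e+s≤t))))
                                   (≋-trans (End-eval (s ⊕ s)) (≡⇒≋ (cong ([_]· 1ₚ) (double-≡ᵇ0 s))))) ⟩
        L (H₊ (suc h) s +ₚ [ s ≡ᵇ 0 ]· 1ₚ)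
          ≈⟨ ≋-cong L-lin (λ a b → uncancel (H (suc h) s a b) _) ⟩
        L (H (suc h) s)
          ≈⟨ ≡⇒≋ (cong (L ∘ H (suc h)) (sym (ℕ.m+n∸m≡n e s))) ⟩
        L (H (suc h) ((e ⊕ s) ∸ e)) ∎
        where
        L = markValley (suc h) (suc e)
        L-lin = markValley-linear (suc h) (suc e)
        uncancel : ∀ x y → x - y + y ≡ x
        uncancel = solve-∀
        double-≡ᵇ0 : ∀ s → (s ⊕ s ≡ᵇ 0) ≡ (s ≡ᵇ 0)
        double-≡ᵇ0 zero    = refl
        double-≡ᵇ0 (suc s) = refl
        peak-offset : ∀ e s → (suc (e ⊕ s) ⊕ suc (e ⊕ s)) ∸ suc e ≡ e ⊕ suc (s ⊕ s)
        peak-offset e s = trans (cong (_∸ suc e) (regroup e s)) (ℕ.m+n∸m≡n (suc e) (e ⊕ suc (s ⊕ s)))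
          where
          regroup : ∀ e s → suc (e ⊕ s) ⊕ suc (e ⊕ s) ≡ suc e ⊕ (e ⊕ suc (s ⊕ s))
          regroup = ℕsolve-∀

walkSum : ℕ → ℕ → Poly
walkSum f n = sumWords (n ⊕ n) (walk f f)

walk-down-from-floor : ∀ f w → walk f f (d ∷ w) ≋ 0ₚ
walk-down-from-floor zero    w = ≋-refl
walk-down-from-floor (suc f) w = []·-false _ (<-irrefl refl ∘ ℕ.<ᵇ⇒< f f)

walkSum-suc : ∀ f n → walkSum f (suc n) ≋ Σ≤ₚ n (λ i → (H₊ (suc f) i +ₚ walkSum (suc f) i) *ₚ walkSum f (n ∸ i))
walkSum-suc f n = begin
  sumWords (suc n ⊕ suc n) (walk f f)
    ≈⟨ ≡⇒≋ (cong (λ m → sumWords (suc m) (walk f f)) (+-suc n n)) ⟩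
  sumWords m (λ w → walk f f (u ∷ w) +ₚ walk f f (d ∷ w))
    ≈⟨ sumWords-cong m (λ w → ≋-trans (+ₚ-cong (≋-refl {walk f f (u ∷ w)}) (walk-down-from-floor f w))
                                      (+ₚ-identityʳ (walk f f (u ∷ w)))) ⟩
  sumWords m (λ w → walk f (suc f) w +ₚ chain (walksAbove f) f w)
    ≈⟨ sumWords-+ m (walk f (suc f)) (chain (walksAbove f) f) ⟩
  sumWords m (walk f (suc f)) +ₚ sumWords m (chain (walksAbove f) f)
    ≈⟨ +ₚ-cong returns chains ⟩
  Σ≤ₚ n (λ i → walkSum (suc f) i *ₚ walkSum f (n ∸ i)) +ₚ Σ≤ₚ n (λ i → H₊ (suc f) i *ₚ walkSum f (n ∸ i))
    ≈⟨ ≋-sym (Σ≤ₚ-+ n _ _) ⟩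
  Σ≤ₚ n (λ i → (walkSum (suc f) i *ₚ walkSum f (n ∸ i)) +ₚ (H₊ (suc f) i *ₚ walkSum f (n ∸ i)))
    ≈⟨ Σ≤ₚ-cong n (λ i _ → ≋-trans (+ₚ-comm (walkSum (suc f) i *ₚ walkSum f (n ∸ i)) _)
                                     (≋-sym (*ₚ-distribʳ-+ₚ (H₊ (suc f) i) (walkSum (suc f) i) (walkSum f (n ∸ i))))) ⟩
  Σ≤ₚ n (λ i → (H₊ (suc f) i +ₚ walkSum (suc f) i) *ₚ walkSum f (n ∸ i)) ∎
  where
  m = suc (n ⊕ n)
  Above Below Chains : ℕ → Poly
  Above a  = sumWords a (walk (suc f) (suc f))
  Below b  = sumWords b (walk f f)
  Chains a = sumWords a (chain endsWord f)
  open FirstPassage f f ≤-refl using (walk-firstPassage)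
  open ChainFactor f f using (chain-factor)
  returns : sumWords m (walk f (suc f)) ≋ Σ≤ₚ n (λ i → walkSum (suc f) i *ₚ walkSum f (n ∸ i))
  returns = begin
    sumWords m (walk f (suc f))
      ≈⟨ sumWords-cong m (λ w → walk-firstPassage w (suc f) ≤-refl) ⟩
    sumWords m (sumDownSplits (λ x y → walk (suc f) (suc f) x *ₚ walk f f y))
      ≈⟨ ≋-trans (sumWords-sumDownSplits (n ⊕ n) _) (sumPairs-*ₚ (n ⊕ n) (walk (suc f) (suc f)) (walk f f)) ⟩
    Σ≤ₚ (n ⊕ n) (λ a → Above a *ₚ Below ((n ⊕ n) ∸ a))
      ≈⟨ Σ≤ₚ-evens n _ (λ a odd-a → vanishes (*ₚ-linearˡ (Below ((n ⊕ n) ∸ a)))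
                          (sumWords-zero a _ (λ w |w|≡a → walk-parity w (suc f) (suc f)
                            (trans (cong odd |w|≡a) (trans odd-a (cong not (sym (odd-double (suc f))))))))) ⟩
    Σ≤ₚ n (λ i → Above (i ⊕ i) *ₚ Below ((n ⊕ n) ∸ (i ⊕ i)))
      ≈⟨ Σ≤ₚ-cong n (λ i i≤n → ≡⇒≋ (cong (λ k → Above (i ⊕ i) *ₚ Below k) (double-∸ n i i≤n))) ⟩
    Σ≤ₚ n (λ i → walkSum (suc f) i *ₚ walkSum f (n ∸ i)) ∎
  chains : sumWords m (chain (walksAbove f) f) ≋ Σ≤ₚ n (λ i → H₊ (suc f) i *ₚ walkSum f (n ∸ i))
  chains = begin
    sumWords m (chain (walksAbove f) f)
      ≈⟨ sumWords-cong m chain-factor ⟩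
    sumWords m (sumSplits (λ c y → chain endsWord f c *ₚ walk f f y))
      ≈⟨ ≋-trans (sumWords-sumSplits m _) (sumPairs-*ₚ m (chain endsWord f) (walk f f)) ⟩
    Σ≤ₚ m (λ a → Chains a *ₚ Below (m ∸ a))
      ≈⟨ Σ≤ₚ-odds n _ (λ a even-a → vanishes (*ₚ-linearˡ (Below (m ∸ a)))
                         (sumWords-zero a _ (λ w |w|≡a → chain-parity w endsWord f (trans (cong odd |w|≡a) even-a)))) ⟩
    Σ≤ₚ n (λ i → Chains (suc (i ⊕ i)) *ₚ Below ((n ⊕ n) ∸ (i ⊕ i)))
      ≈⟨ Σ≤ₚ-cong n (λ i i≤n → *ₚ-cong (ChainSum.chain-sum f i) (≡⇒≋ (cong Below (double-∸ n i i≤n)))) ⟩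
    Σ≤ₚ n (λ i → H₊ (suc f) i *ₚ walkSum f (n ∸ i)) ∎

walkSum≋Gtrunc : ∀ n M f → n < M → walkSum f n ≋ Gtrunc M (suc f) n
walkSum≋Gtrunc = <-rec (λ n → ∀ M f → n < M → walkSum f n ≋ Gtrunc M (suc f) n) step
  where
  step : ∀ n → (∀ {i} → i < n → ∀ M f → i < M → walkSum f i ≋ Gtrunc M (suc f) i) →
         ∀ M f → n < M → walkSum f n ≋ Gtrunc M (suc f) n
  step zero    IH (suc M) f _ = []·-true 1ₚ (ℕ.≡⇒≡ᵇ f f refl)
  step (suc n) IH (suc M) f (s≤s n<M) = begin
    walkSum f (suc n)
      ≈⟨ walkSum-suc f n ⟩
    Σ≤ₚ n (λ i → (H₊ (suc f) i +ₚ walkSum (suc f) i) *ₚ walkSum f (n ∸ i))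
      ≈⟨ Σ≤ₚ-cong n (λ i i≤n → *ₚ-cong (+ₚ-cong (≋-refl {H₊ (suc f) i}) (IH (s≤s i≤n) M (suc f) (ℕ.≤-<-trans i≤n n<M)))
                                        (IH (s≤s (m∸n≤m n i)) (suc M) f (s≤s (≤-trans (m∸n≤m n i) (<⇒≤ n<M))))) ⟩
    Σ≤ₚ n (λ i → (H₊ (suc f) i +ₚ Gtrunc M (suc (suc f)) i) *ₚ Gtrunc (suc M) (suc f) (n ∸ i))
      ≈⟨ ≋-sym (Gtrunc-suc M (suc f) n) ⟩
    Gtrunc (suc M) (suc f) (suc n) ∎

-- Symmetric valleys of Dyck paths

data NotUp : List Step → Set where
  nil  : NotUp []
  down : ∀ w → NotUp (d ∷ w)

data UpRun : List Step → Set where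
  upRun : ∀ b r → NotUp r → UpRun (replicate b u ++ r)

upRun? : ∀ w → UpRun w
upRun? []      = upRun 0 [] nil
upRun? (d ∷ w) = upRun 0 (d ∷ w) (down w)
upRun? (u ∷ w) with upRun? w
... | upRun b r r-notUp = upRun (suc b) r r-notUp

data Descent : List Step → Set where
  empty  : Descent []
  up     : ∀ w → Descent (u ∷ w)
  downs  : ∀ a → Descent (replicate (suc a) d)
  valley : ∀ a b r → NotUp r → Descent (replicate (suc a) d ++ replicate (suc b) u ++ r)

descent : ∀ w → Descent w
descent []      = empty
descent (u ∷ w) = up w
descent (d ∷ w) with descent w
... | empty               = downs 0
... | downs a             = downs (suc a)
... | valley a b r r-notUp = valley (suc a) b r r-notUp
... | up w′ with upRun? w′
...   | upRun b r r-notUp = valley 0 b r r-notUp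

runs-cons : ∀ x xs → ∃₂ λ k rs → runs (x ∷ xs) ≡ (x , k) ∷ rs
runs-cons x xs with runs xs
... | [] = 1 , [] , refl
runs-cons u xs | (u , k) ∷ rs = suc k , rs , refl
runs-cons u xs | (d , k) ∷ rs = 1 , (d , k) ∷ rs , refl
runs-cons d xs | (u , k) ∷ rs = 1 , (u , k) ∷ rs , refl
runs-cons d xs | (d , k) ∷ rs = suc k , rs , refl

valleys-up : ∀ w → valleys (u ∷ w) ≡ valleys w
valleys-up w with runs w
... | []           = refl
... | (u , k) ∷ rs = refl
... | (d , k) ∷ rs = refl

runs-ups : ∀ b r → NotUp r → runs (replicate (suc b) u ++ r) ≡ (u , suc b) ∷ runs r
runs-ups zero    []      nil      = refl
runs-ups zero    (d ∷ w) (down w) with runs-cons d w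
... | k , rs , runs≡ rewrite runs≡ = refl
runs-ups (suc b) r r-notUp rewrite runs-ups b r r-notUp = refl

runs-downs-up : ∀ a w → runs (replicate (suc a) d ++ u ∷ w) ≡ (d , suc a) ∷ runs (u ∷ w)
runs-downs-up zero    w with runs-cons u w
... | k , rs , runs≡ rewrite runs≡ = refl
runs-downs-up (suc a) w rewrite runs-downs-up a w = refl

runs-downs : ∀ a → runs (replicate (suc a) d) ≡ (d , suc a) ∷ []
runs-downs zero    = refl
runs-downs (suc a) rewrite runs-downs a = refl

valleys-downs : ∀ a → valleys (replicate (suc a) d) ≡ []
valleys-downs a rewrite runs-downs a = refl

valleys-valley : ∀ a b r → NotUp r →
                 valleys (replicate (suc a) d ++ replicate (suc b) u ++ r) ≡ (suc a , suc b) ∷ valleys r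
valleys-valley a b r r-notUp rewrite runs-downs-up a (replicate b u ++ r) | runs-ups b r r-notUp = refl

dyckFrom-downs : ∀ A H r → dyckFrom (A ⊕ H) (replicate A d ++ r) ≡ dyckFrom H r
dyckFrom-downs zero    H r = refl
dyckFrom-downs (suc A) H r = dyckFrom-downs A H r

dyckFrom-downs-below : ∀ A H r → H < A → dyckFrom H (replicate A d ++ r) ≡ false
dyckFrom-downs-below (suc A) zero    r _         = refl
dyckFrom-downs-below (suc A) (suc H) r (s≤s H<A) = dyckFrom-downs-below A H r H<A

dyckFrom-ups : ∀ B H r → dyckFrom H (replicate B u ++ r) ≡ dyckFrom (B ⊕ H) r
dyckFrom-ups zero    H r = refl
dyckFrom-ups (suc B) H r = trans (dyckFrom-ups B (suc H) r) (cong (λ k → dyckFrom k r) (+-suc B H))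

walk-downs : ∀ A H r → walk 0 (A ⊕ H) (replicate A d ++ r) ≡ walk 0 H r
walk-downs zero    H r = refl
walk-downs (suc A) H r = walk-downs A H r

walk-downs-below : ∀ A H r → H < A → walk 0 H (replicate A d ++ r) ≋ 0ₚ
walk-downs-below (suc A) zero    r _         = ≋-refl
walk-downs-below (suc A) (suc H) r (s≤s H<A) = walk-downs-below A H r H<A

walk-downs-only : ∀ A H → walk 0 H (replicate A d) ≋ [ dyckFrom H (replicate A d) ]· 1ₚ
walk-downs-only zero    zero    = ≋-refl
walk-downs-only zero    (suc H) = ≋-refl
walk-downs-only (suc A) zero    = ≋-refl
walk-downs-only (suc A) (suc H) = walk-downs-only A H

walk-ups : ∀ B H r → walk 0 H (replicate (suc B) u ++ r) ≋ walk 0 (B ⊕ H) (u ∷ r)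
walk-ups zero    H r = ≋-refl
walk-ups (suc B) H r =
  ≋-trans (+ₚ-identityʳ _) (≋-trans (walk-ups B (suc H) r) (≡⇒≋ (cong (λ k → walk 0 k (u ∷ r)) (+-suc B H))))

chainDown-downs : ∀ t h i A r → chainDown t h i (replicate A d ++ r) ≡ chainDown t h (i ⊕ A) r
chainDown-downs t h i zero    r = cong (λ k → chainDown t h k r) (sym (+-identityʳ i))
chainDown-downs t h i (suc A) r = trans (chainDown-downs t h (suc i) A r) (cong (λ k → chainDown t h k r) (sym (+-suc i A)))

chainUp-ups : ∀ t h v j r → chainUp t h v j (replicate j u ++ r) ≡ chainUp t h v 0 r
chainUp-ups t h v zero    r = refl
chainUp-ups t h v (suc j) r = chainUp-ups t h v j r

chainUp-mismatch : ∀ t h v j k r → NotUp r → j ≢ k → chainUp t h v j (replicate k u ++ r) ≋ 0ₚ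
chainUp-mismatch t h v zero    zero    r       _        j≢k = ⊥-elim (j≢k refl)
chainUp-mismatch t h v zero    (suc k) r       _        _   = ≋-refl
chainUp-mismatch t h v (suc j) zero    []      nil      _   = ≋-refl
chainUp-mismatch t h v (suc j) zero    (d ∷ w) (down w) _   = ≋-refl
chainUp-mismatch t h v (suc j) (suc k) r       r-notUp  j≢k = chainUp-mismatch t h v j k r r-notUp (j≢k ∘ cong suc)

chainUp-closes : ∀ h v r → NotUp r → chainUp (walksAbove 0) h v 0 r ≋ markValley (suc h) v (walk 0 h (u ∷ r))
chainUp-closes h v []       nil      = ≋-sym (vanishes (markValley-linear (suc h) v) (+ₚ-identityʳ 0ₚ))
chainUp-closes h v (d ∷ r′) (down r′) =
  ≋-cong (markValley-linear (suc h) v) (+ₚ-comm (chainDown (walksAbove 0) h 0 r′) (walk 0 h r′))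

valleyWeight : List (ℕ × ℕ) → Poly
valleyWeight []             = 1ₚ
valleyWeight ((i , j) ∷ vs) = if i ≡ᵇ j then s^ 1 · w^ i · valleyWeight vs else valleyWeight vs

if-T : ∀ {b} (x y : Poly) → T b → (if b then x else y) ≋ x
if-T {true} x y _ = ≋-refl

if-¬T : ∀ {b} (x y : Poly) → ¬ T b → (if b then x else y) ≋ y
if-¬T {true}  x y ¬b = ⊥-elim (¬b _)
if-¬T {false} x y _  = ≋-refl

chain-valley : ∀ h a b r → NotUp r →
               chain (walksAbove 0) h (replicate (suc a) d ++ replicate (suc b) u ++ r) ≋
               [ a ≡ᵇ b ]· markValley (suc h) (suc a) (walk 0 h (u ∷ r))
chain-valley h a b r r-notUp
  rewrite chainDown-downs (walksAbove 0) h 0 a (replicate (suc b) u ++ r) with a ℕ.≟ b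
... | yes refl = ≋-trans (≡⇒≋ (chainUp-ups (walksAbove 0) h (suc a) a r))
                         (≋-trans (chainUp-closes h (suc a) r r-notUp) (≋-sym ([]·-true _ (ℕ.≡⇒≡ᵇ a a refl))))
... | no  a≢b  = ≋-trans (chainUp-mismatch (walksAbove 0) h (suc a) a b r r-notUp a≢b)
                         (≋-sym ([]·-false _ (a≢b ∘ ℕ.≡ᵇ⇒≡ a b)))

read-or-mark : ∀ c {b b′} i V → (T c → b′ ≡ b) →
               ([ b ]· V +ₚ [ c ]· mark i ([ b′ ]· V)) ≋ [ b ]· (if c then s^ 1 · w^ i · V else V)
read-or-mark false     i V _    = +ₚ-identityʳ _
read-or-mark true {b} i V b′≡b rewrite b′≡b _ =
  ≋-trans (λ x y → uncancel (([ b ]· V) x y) _) ([]·-commute (∘-linear (s^-linear 1) (w^-linear i)) b V)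
  where
  uncancel : ∀ x y → x + (y - x) ≡ y
  uncancel = solve-∀

module _ (a b : ℕ) (r : List Step) (r-notUp : NotUp r)
         (IH : ∀ H → walk 0 H (u ∷ r) ≋ [ dyckFrom (suc H) r ]· valleyWeight (valleys r)) where

  private
    W = replicate (suc a) d ++ replicate (suc b) u ++ r
    V = valleyWeight (valleys r)
    Goal : ℕ → Set
    Goal h = walk 0 h (u ∷ W) ≋ [ dyckFrom (suc h) W ]· valleyWeight ((suc a , suc b) ∷ valleys r)

  walk-valley-above : ∀ s → Goal (a ⊕ s)
  walk-valley-above s = begin
    walk 0 (suc a ⊕ s) W +ₚ chain (walksAbove 0) (a ⊕ s) W
      ≈⟨ +ₚ-cong (≋-trans (≡⇒≋ (walk-downs (suc a) s _)) (≋-trans (walk-ups b s r) (IH (b ⊕ s))))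
                 (≋-trans (chain-valley (a ⊕ s) a b r r-notUp)
                          ([]·-cong (a ≡ᵇ b) (λ _ → ≋-trans ([]·-true _ (ℕ.<⇒<ᵇ (s≤s (s≤s (ℕ.m≤m+n a s)))))
                                                            (≋-cong (mark-linear (suc a)) (IH (a ⊕ s)))))) ⟩
    [ dyckFrom (suc (b ⊕ s)) r ]· V +ₚ [ a ≡ᵇ b ]· mark (suc a) ([ dyckFrom (suc (a ⊕ s)) r ]· V)
      ≈⟨ read-or-mark (a ≡ᵇ b) (suc a) V (λ a≡ᵇb → cong (λ k → dyckFrom (suc (k ⊕ s)) r) (ℕ.≡ᵇ⇒≡ a b a≡ᵇb)) ⟩
    [ dyckFrom (suc (b ⊕ s)) r ]· valleyWeight ((suc a , suc b) ∷ valleys r)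
      ≈⟨ ≡⇒≋ (cong ([_]· _) (sym (trans (dyckFrom-downs (suc a) s _) (dyckFrom-ups (suc b) s r)))) ⟩
    [ dyckFrom (suc (a ⊕ s)) W ]· valleyWeight ((suc a , suc b) ∷ valleys r) ∎

  walk-valley-below : ∀ h → h < a → Goal h
  walk-valley-below h h<a = begin
    walk 0 (suc h) W +ₚ chain (walksAbove 0) h W
      ≈⟨ +ₚ-cong (walk-downs-below (suc a) (suc h) _ (s≤s h<a))
                 (≋-trans (chain-valley h a b r r-notUp)
                          ([]·-cong (a ≡ᵇ b) (λ _ → []·-false _ (<⇒≱ h<a ∘ ℕ.≤-pred ∘ ℕ.<ᵇ⇒< a (suc h))))) ⟩
    0ₚ +ₚ [ a ≡ᵇ b ]· 0ₚ
      ≈⟨ ≋-trans (+ₚ-identityˡ _) (0ₚ-homo ([]·-linear (a ≡ᵇ b))) ⟩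
    0ₚ
      ≈⟨ ≋-sym ([]·-false _ (subst T (dyckFrom-downs-below (suc a) (suc h) _ (s≤s h<a)))) ⟩
    [ dyckFrom (suc h) W ]· valleyWeight ((suc a , suc b) ∷ valleys r) ∎

  walk-valley : ∀ h → walk 0 h (u ∷ W) ≋ [ dyckFrom (suc h) W ]· valleyWeight ((suc a , suc b) ∷ valleys r)
  walk-valley h with a ℕ.≤? h
  ... | yes a≤h = subst Goal (ℕ.m+[n∸m]≡n a≤h) (walk-valley-above (h ∸ a))
  ... | no  a≰h = walk-valley-below h (ℕ.≰⇒> a≰h)

walk-after-up : ∀ w h → walk 0 h (u ∷ w) ≋ [ dyckFrom (suc h) w ]· valleyWeight (valleys w)
walk-after-up w = <-rec P step (length w) w refl
  where
  P : ℕ → Set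
  P n = ∀ w → length w ≡ n → ∀ h → walk 0 h (u ∷ w) ≋ [ dyckFrom (suc h) w ]· valleyWeight (valleys w)
  step : ∀ n → (∀ {m} → m < n → P m) → P n
  step n IH w refl h with descent w
  ... | empty    = ≋-refl
  ... | up w′    = ≋-trans (+ₚ-identityʳ _)
                     (≋-trans (IH ℕ.≤-refl w′ refl (suc h))
                              (≡⇒≋ (cong (λ vs → [ dyckFrom (suc (suc h)) w′ ]· valleyWeight vs) (sym (valleys-up w′)))))
  ... | downs a rewrite valleys-downs a =
    ≋-trans (+ₚ-cong (walk-downs-only (suc a) (suc h))
                     (≡⇒≋ (trans (cong (chainDown (walksAbove 0) h 0) (sym (++-identityʳ (replicate a d))))
                                 (chainDown-downs (walksAbove 0) h 0 a []))))
            (+ₚ-identityʳ _)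
  ... | valley a b r r-notUp rewrite valleys-valley a b r r-notUp =
    walk-valley a b r r-notUp (IH (shorter a b r) r refl) h
    where
    shorter : ∀ a b r → length r < length (replicate (suc a) d ++ replicate (suc b) u ++ r)
    shorter a b r rewrite length-++ (replicate a d) {u ∷ replicate b u ++ r} | length-++ (replicate b u) {r} =
      s≤s (≤-trans (ℕ.m≤n+m (length r) (length (replicate b u)))
                   (≤-trans (ℕ.n≤1+n _) (ℕ.m≤n+m _ (length (replicate a d)))))

s^-+ : ∀ k m p → s^ k · s^ m · p ≋ s^ (k ⊕ m) · p
s^-+ zero    m p = ≋-refl
s^-+ (suc k) m p zero    b = refl
s^-+ (suc k) m p (suc a) b = s^-+ k m p a b

s^-w^-comm : ∀ k m p → s^ k · w^ m · p ≋ w^ m · s^ k · p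
s^-w^-comm zero    m       p = ≋-refl
s^-w^-comm (suc k) zero    p = ≋-refl
s^-w^-comm (suc k) (suc m) p zero    zero    = refl
s^-w^-comm (suc k) (suc m) p zero    (suc b) = s^-w^-comm (suc k) m p zero b
s^-w^-comm (suc k) (suc m) p (suc a) zero    = s^-w^-comm k (suc m) p a zero
s^-w^-comm (suc k) (suc m) p (suc a) (suc b) =
  trans (s^-w^-comm k (suc m) p a (suc b)) (trans (sym (s^-w^-comm k m p a b)) (s^-w^-comm (suc k) m p (suc a) b))

monomial-eval : ∀ x y a b → monomial x y a b ≡ (if (x ≡ᵇ a) ∧ (y ≡ᵇ b) then + 1 else 0ℤ)
monomial-eval zero    zero    zero    zero    = refl
monomial-eval zero    zero    zero    (suc b) = refl
monomial-eval zero    zero    (suc a) b       = refl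
monomial-eval zero    (suc y) zero    zero    = refl
monomial-eval zero    (suc y) (suc a) zero    = refl
monomial-eval zero    (suc y) a       (suc b) = monomial-eval zero y a b
monomial-eval (suc x) y       zero    b       = refl
monomial-eval (suc x) y       (suc a) b       = monomial-eval x y a b

symmetric : List (ℕ × ℕ) → List (ℕ × ℕ)
symmetric = filterᵇ (λ { (i , j) → i ≡ᵇ j })

valleyWeight≋monomial : ∀ vs → valleyWeight vs ≋ monomial (length (symmetric vs)) (sum (map proj₁ (symmetric vs)))
valleyWeight≋monomial []             = ≋-refl
valleyWeight≋monomial ((i , j) ∷ vs) with i ≡ᵇ j
... | false = valleyWeight≋monomial vs
... | true  = begin
  s^ 1 · w^ i · valleyWeight vs            ≈⟨ ≋-cong (∘-linear (s^-linear 1) (w^-linear i)) (valleyWeight≋monomial vs) ⟩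
  s^ 1 · w^ i · s^ L · w^ S · 1ₚ           ≈⟨ ≋-cong (s^-linear 1) (≋-sym (s^-w^-comm L i _)) ⟩
  s^ 1 · s^ L · w^ i · w^ S · 1ₚ           ≈⟨ s^-+ 1 L _ ⟩
  s^ suc L · w^ i · w^ S · 1ₚ              ≈⟨ ≋-cong (s^-linear (suc L)) (w^-+ i S 1ₚ) ⟩
  monomial (suc L) (i ⊕ S)                 ∎
  where
  L = length (symmetric vs)
  S = sum (map proj₁ (symmetric vs))

walk-counts : ∀ w → walk 0 0 w ≋ [ isDyck w ]· monomial (sval w) (svw w)
walk-counts []      = ≋-refl
walk-counts (d ∷ w) = ≋-refl
walk-counts (u ∷ w) = begin
  walk 0 0 (u ∷ w)
    ≈⟨ walk-after-up w 0 ⟩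
  [ dyckFrom 1 w ]· valleyWeight (valleys w)
    ≈⟨ []·-cong (dyckFrom 1 w) (λ _ → valleyWeight≋monomial (valleys w)) ⟩
  [ dyckFrom 1 w ]· monomial (sval w) (svw w)
    ≈⟨ ≡⇒≋ (cong (λ vs → [ dyckFrom 1 w ]· monomial (length (symmetric vs)) (sum (map proj₁ (symmetric vs))))
                 (sym (valleys-up w))) ⟩
  [ isDyck (u ∷ w) ]· monomial (sval (u ∷ w)) (svw (u ∷ w)) ∎

-- Counting Dyck paths

sumList : (List Step → Poly) → List (List Step) → Poly
sumList F []       = 0ₚ
sumList F (w ∷ ws) = F w +ₚ sumList F ws

sumList-extend : ∀ F ws → sumList F (concatMap (λ w → (u ∷ w) ∷ (d ∷ w) ∷ []) ws) ≋
                          sumList (λ w → F (u ∷ w) +ₚ F (d ∷ w)) ws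
sumList-extend F []       = ≋-refl
sumList-extend F (w ∷ ws) a b =
  trans (cong (λ r → F (u ∷ w) a b + (F (d ∷ w) a b + r)) (sumList-extend F ws a b)) (sym (ℤ.+-assoc (F (u ∷ w) a b) _ _))

sumWords≋sumList : ∀ m F → sumWords m F ≋ sumList F (words m)
sumWords≋sumList zero    F = ≋-sym (+ₚ-identityʳ (F []))
sumWords≋sumList (suc m) F = ≋-trans (sumWords≋sumList m _) (≋-sym (sumList-extend F (words m)))

count-dyck : ∀ a b ws → + length (filterᵇ (λ p → (sval p ≡ᵇ a) ∧ (svw p ≡ᵇ b)) (filterᵇ isDyck ws)) ≡
                        sumList (λ w → [ isDyck w ]· monomial (sval w) (svw w)) ws a b
count-dyck a b []       = refl
count-dyck a b (w ∷ ws) with isDyck w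
... | false = trans (count-dyck a b ws) (sym (ℤ.+-identityˡ _))
... | true rewrite monomial-eval (sval w) (svw w) a b with (sval w ≡ᵇ a) ∧ (svw w ≡ᵇ b)
...   | false = trans (count-dyck a b ws) (sym (ℤ.+-identityˡ _))
...   | true  = cong (λ r → + 1 + r) (count-dyck a b ws)

dyckGF≋walkSum : ∀ n → dyckGF n ≋ walkSum 0 n
dyckGF≋walkSum n = begin
  dyckGF n                                                               ≈⟨ (λ a b → count-dyck a b (words (n ⊕ n))) ⟩
  sumList (λ w → [ isDyck w ]· monomial (sval w) (svw w)) (words (n ⊕ n)) ≈⟨ ≋-sym (sumWords≋sumList (n ⊕ n) _) ⟩
  sumWords (n ⊕ n) (λ w → [ isDyck w ]· monomial (sval w) (svw w))       ≈⟨ ≋-sym (sumWords-cong (n ⊕ n) walk-counts) ⟩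
  walkSum 0 n                                                            ∎

theorem3p3 : ∀ (n : ℕ) → ∃[ N ] ∀ (M : ℕ) → N ≤ M → ∀ (a b : ℕ) →
    dyckGF n a b ≡ Gtrunc M 1 n a b
theorem3p3 n = suc n , λ M n<M a b → trans (dyckGF≋walkSum n a b) (walkSum≋Gtrunc n M 0 n<M a b)
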